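{- For every integer $m \in \mathbb{Z}$ and every integer $r \geq 0$, the following identities of linear operators on $\operatorname{NSym}$ hold: \[ F_r^\perp \mathbb{B}_m = \sum_{j=0}^r \mathbb{B}_{m-j} F_{r-j}^\perp \qquad\text{and}\qquad H_m^L = \sum_{r \geq 0} \mathbb{B}_{m+r} F_r^\perp . \]
   Context: $\operatorname{NSym}$ is the free associative (non-commutative) algebra over $\mathbb{Q}$ on generators $H_1, H_2, \dots$, graded with $H_i$ of degree $i$; set $H_0 = 1$ and $H_{ -r} = 0$ for $r > 0$, and $H_\alpha = H_{\alpha_1}\cdots H_{\alpha_m}$ for a composition $\alpha$. $\operatorname{QSym}$ is the algebra of quasi-symmetric functions, the graded dual of $\operatorname{NSym}$ under the pairing $\langle H_\alpha, M_\beta\rangle = \delta_{\alpha,\beta}$, where $M_\beta$ are the monomial quasi-symmetric functions. For compositions $\alpha,\beta$ of $n$, $\beta \le \alpha$ (refinement) means the set of partial sums of $\alpha$ (excluding $n$) is contained in that of $\beta$; the fundamental quasi-symmetric function is $F_\alpha = \sum_{\beta \le \alpha} M_\beta$. In particular $F_r$ ($r \ge 1$) is indexed by the one-part composition $[r]$ and $F_{1^i}$ by $[1,\dots,1]$ ($i$ ones); $F_0 = 1$ and $F_d = 0$ for $d<0$. For $F \in \operatorname{QSym}$, $F^\perp$ is the operator on $\operatorname{NSym}$ defined by $\langle F^\perp H, G\rangle = \langle H, FG\rangle$ for all $G \in \operatorname{QSym}$. $H_m^L$ denotes the operator of left multiplication by $H_m$ on $\operatorname{NSym}$. For $m \in \mathbb{Z}$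 the non-commutative Bernstein operator is $\mathbb{B}_m = \sum_{i \ge 0} (-1)^i H_{m+i}^L F_{1^i}^\perp$ (a finite sum on each homogeneous element). -}

module Defs where

open import Data.Nat as ℕ using (ℕ; zero; suc; _∸_)
open import Data.Integer as ℤ using (ℤ; +_; -[1+_])
open import Data.Rational as ℚ using (ℚ; 0ℚ; 1ℚ)
open import Data.List using (List; []; _∷_; _++_; map; concatMap; upTo; replicate; filterᵇ)
open import Data.Bool.ListAction using (all; any)
open import Data.List.Properties using (≡-dec)
open import Data.Product using (_×_; _,_)
open import Data.Bool using (Bool; if_then_else_)
open import Relation.Nullary.Decidable using (does)
open import Relation.Binary.PropositionalEquality using (_≡_)

-- Compositions.  ENCODING: a composition is a list of naturals where an
-- entry p stands for the (positive) part  p + 1.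

Comp : Set
Comp = List ℕ

size : Comp → ℕ
size []      = 0
size (p ∷ α) = suc p ℕ.+ size α

-- all compositions of n (each exactly once): a composition of n+1 arises
-- from one of n either by prepending a new part 1 or by adding 1 to the
-- first part.
compsOf : ℕ → List Comp
compsOf zero    = [] ∷ []
compsOf (suc n) = concatMap step (compsOf n)
  where
  step : Comp → List Comp
  step []      = (0 ∷ []) ∷ []
  step (p ∷ c) = (0 ∷ p ∷ c) ∷ (suc p ∷ c) ∷ []

-- set of partial sums of α, excluding the total  n = |α|
psumsFrom : ℕ → Comp → List ℕ
psumsFrom acc []              = []
psumsFrom acc (p ∷ [])        = []
psumsFrom acc (p ∷ c@(q ∷ _)) = (acc ℕ.+ suc p) ∷ psumsFrom (acc ℕ.+ suc p) c

psums : Comp → List ℕ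
psums = psumsFrom 0

_∈ᵇ_ : ℕ → List ℕ → Bool
n ∈ᵇ xs = any (λ x → x ℕ.≡ᵇ n) xs

_≤ʳ_ : Comp → Comp → Bool
β ≤ʳ α = all (λ s → s ∈ᵇ psums β) (psums α)

-- For NSym the basis is H_α, for QSym it is M_α.

Lin : Set
Lin = List (ℚ × Comp)

NSym : Set
NSym = Lin

QSym : Set
QSym = Lin

coeff : Lin → Comp → ℚ
coeff []             α = 0ℚ
coeff ((c , β) ∷ x) α =
  if does (≡-dec ℕ._≟_ β α) then c ℚ.+ coeff x α else coeff x α

infix 4 _≈_
_≈_ : Lin → Lin → Set
x ≈ y = ∀ α → coeff x α ≡ coeff y α

scale : ℚ → Lin → Lin
scale c = map (λ { (d , β) → (c ℚ.* d , β) })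

linExt : (Comp → Lin) → Lin → Lin
linExt f = concatMap (λ { (c , α) → scale c (f α) })

basis : Comp → Lin
basis α = (1ℚ , α) ∷ []

H : Comp → NSym
H = basis

M : Comp → QSym
M = basis

qsh : Comp → Comp → List Comp
qsh []            β             = β ∷ []
qsh α@(_ ∷ _)     []            = α ∷ []
qsh aα@(a ∷ α)    bβ@(b ∷ β)    =
  map (a ∷_) (qsh α bβ) ++ map (b ∷_) (qsh aα β) ++ map (suc (a ℕ.+ b) ∷_) (qsh α β)

_*Q_ : QSym → QSym → QSym
x *Q y = concatMap (λ { (c , α) →
           concatMap (λ { (d , β) → map (λ γ → (c ℚ.* d , γ)) (qsh α β) }) y }) x

F : Comp → QSym
F α = map (λ β → (1ℚ , β)) (filterᵇ (λ β → β ≤ʳ α) (compsOf (size α)))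

Fr : ℕ → QSym
Fr zero    = F []
Fr (suc k) = F (k ∷ [])

F1s : ℕ → QSym
F1s i = F (replicate i 0)

Op : Set
Op = NSym → NSym

sumTo : ℕ → (ℕ → NSym) → NSym
sumTo n f = concatMap f (upTo (suc n))

-- G^⊥ : ⟨G^⊥ H_α , M_β⟩ = ⟨H_α , G M_β⟩, i.e.
-- G^⊥ H_α = Σ_β ⟨H_α , G M_β⟩ H_β ; only |β| ≤ |α| can contribute
-- (G M_β has all its terms of size ≥ |β|).
perp : QSym → Op
perp G = linExt (λ α →
  concatMap (λ k → map (λ β → (coeff (G *Q M β) α , β)) (compsOf k))
            (upTo (suc (size α))))

-- H_m^L : left multiplication by H_m  (H_0 = 1, H_{-r} = 0)
HL : ℤ → Op
HL m = linExt (hl m)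
  where
  hl : ℤ → Comp → NSym
  hl (+ zero)  α = H α
  hl (+ suc k) α = H (k ∷ α)
  hl -[1+ _ ]  α = []

-- "infinite" operator sum  Σ_{i ≥ 0} T i , evaluated on H_α as the
-- partial sum up to i = |α| (used only for families whose terms vanish
-- on H_α for i > |α|), extended linearly.
series : (ℕ → Op) → Op
series T = linExt (λ α → sumTo (size α) (λ i → T i (H α)))

sign : ℕ → ℚ
sign zero    = 1ℚ
sign (suc i) = ℚ.- sign i

𝔹 : ℤ → Op
𝔹 m = series (λ i x → scale (sign i) (HL (m ℤ.+ + i) (perp (F1s i) x)))

module Submission where

-- Everything is checked on the basis H_α and extended by linearity. An adjoint G^⊥ acts on H_α
-- through the coproduct ΔH_α = Σ H_a ⊗ H_b, which is dual to the quasi-shuffle product of QSym: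
-- G^⊥ H_α = Σ ⟨H_a , G⟩ H_b, where ⟨H_a , F_r⟩ = [|a| = r] and ⟨H_a , F_{1^i}⟩ = [a = 1^i].
-- Cocommutativity of Δ makes all adjoints commute, and ΔF_r = Σ_j F_j ⊗ F_{r−j} gives
-- F_r^⊥ H_m^L = Σ_j H_{m−j}^L F_{r−j}^⊥. Pushing F_r^⊥ through the sum defining 𝔹_m with these two
-- facts gives the first identity. For the second, Σ_r 𝔹_{m+r} F_r^⊥ H_α expands over the iterated
-- coproduct of H_α, and within each part of α the signed terms telescope, as in
-- Σ_i (−1)^i e_i h_{n−i} = δ_{n,0}, leaving H_m H_α.


open import Defs
open import Algebra.Bundles using (CommutativeMonoid)
import Algebra.Properties.CommutativeSemigroup
open import Data.Bool using (Bool; true; false; T; if_then_else_; _∧_; _∨_; not)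
open import Data.Bool.ListAction using (all)
open import Data.Bool.Properties using (∧-zeroʳ)
open import Data.Empty using (⊥-elim)
open import Data.Integer as ℤ using (ℤ; +_; -[1+_]; _+_; _-_)
import Data.Integer.Properties as ℤP
open import Data.List using (List; []; [_]; _∷_; _++_; map; concatMap; length; upTo; filterᵇ; replicate)
import Data.List.Properties as LP
open import Data.List.Properties using (≡-dec)
open import Data.Nat as ℕ using (ℕ; zero; suc; z≤n; s≤s; _∸_)
import Data.Nat.Properties as ℕP
open import Data.Product using (Σ; _×_; _,_; proj₁; proj₂)
open import Data.Rational as ℚ using (ℚ; 0ℚ; 1ℚ; _*_; -_)
import Data.Rational.Properties as ℚP
open import Data.Rational.Solver
open import Data.Sum using (inj₁; inj₂)
open import Data.Unit using (tt)
open import Function using (_∘_)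
open import Level using (0ℓ)
open import Relation.Binary.Bundles using (Setoid)
import Relation.Binary.Reasoning.Setoid
open import Relation.Binary.Definitions using (DecidableEquality)
open import Relation.Binary.PropositionalEquality hiding ([_])
open import Relation.Nullary using (Dec; yes; no; ¬_)
open import Relation.Nullary.Decidable using (does; dec-true; dec-false)

open +-*-Solver using (solve; _:+_; _:*_; :-_; _:=_; con)
module ℚ+ = Algebra.Properties.CommutativeSemigroup
  (CommutativeMonoid.commutativeSemigroup ℚP.+-0-commutativeMonoid)
module ℕ+ = Algebra.Properties.CommutativeSemigroup ℕP.+-commutativeSemigroup

_≟ᶜ_ : DecidableEquality Comp
_≟ᶜ_ = ≡-dec ℕ._≟_

_==ᶜ_ : Comp → Comp → Bool
α ==ᶜ β = does (α ≟ᶜ β)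

==ᶜ-false : ∀ {α β} → α ≢ β → (α ==ᶜ β) ≡ false
==ᶜ-false {α} {β} = dec-false (α ≟ᶜ β)

-- Coefficientwise equality ≈ wrapped in a record, so that both sides can be inferred from a proof.
infix 4 _≋_
record _≋_ (x y : Lin) : Set where
  constructor ⟪_⟫
  field coeff-≡ : x ≈ y
open _≋_ public

≋-refl : ∀ {x} → x ≋ x
≋-refl = ⟪ (λ _ → refl) ⟫

≋-sym : ∀ {x y} → x ≋ y → y ≋ x
≋-sym p = ⟪ (λ α → sym (coeff-≡ p α)) ⟫

≋-trans : ∀ {x y z} → x ≋ y → y ≋ z → x ≋ z
≋-trans p q = ⟪ (λ α → trans (coeff-≡ p α) (coeff-≡ q α)) ⟫

≋-reflexive : ∀ {x y} → x ≡ y → x ≋ y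
≋-reflexive refl = ≋-refl

≋-setoid : Setoid 0ℓ 0ℓ
≋-setoid = record
  { Carrier = Lin ; _≈_ = _≋_
  ; isEquivalence = record { refl = ≋-refl ; sym = ≋-sym ; trans = ≋-trans } }

module ≋-Reasoning = Relation.Binary.Reasoning.Setoid ≋-setoid

coeff-++ : ∀ x y α → coeff (x ++ y) α ≡ coeff x α ℚ.+ coeff y α
coeff-++ [] y α = sym (ℚP.+-identityˡ _)
coeff-++ ((c , β) ∷ x) y α with β ==ᶜ α
... | true  = trans (cong (c ℚ.+_) (coeff-++ x y α)) (sym (ℚP.+-assoc c _ _))
... | false = coeff-++ x y α

coeff-scale : ∀ c x α → coeff (scale c x) α ≡ c * coeff x α
coeff-scale c [] α = sym (ℚP.*-zeroʳ c)
coeff-scale c ((d , β) ∷ x) α with β ==ᶜ α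
... | true  = trans (cong (c * d ℚ.+_) (coeff-scale c x α)) (sym (ℚP.*-distribˡ-+ c d _))
... | false = coeff-scale c x α

coeff-single : ∀ c β → coeff ((c , β) ∷ []) β ≡ c
coeff-single c β rewrite dec-true (β ≟ᶜ β) refl = ℚP.+-identityʳ c

++-cong : ∀ {x x′ y y′} → x ≋ x′ → y ≋ y′ → x ++ y ≋ x′ ++ y′
++-cong {x} {x′} {y} {y′} p q = ⟪ (λ α → begin
  coeff (x ++ y) α            ≡⟨ coeff-++ x y α ⟩
  coeff x α ℚ.+ coeff y α     ≡⟨ cong₂ ℚ._+_ (coeff-≡ p α) (coeff-≡ q α) ⟩
  coeff x′ α ℚ.+ coeff y′ α   ≡⟨ coeff-++ x′ y′ α ⟨
  coeff (x′ ++ y′) α          ∎) ⟫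
  where open ≡-Reasoning

++-congˡ : ∀ x {y y′} → y ≋ y′ → x ++ y ≋ x ++ y′
++-congˡ x = ++-cong (≋-refl {x})

++-comm : ∀ x y → x ++ y ≋ y ++ x
++-comm x y = ⟪ (λ α → trans (coeff-++ x y α)
  (trans (ℚP.+-comm (coeff x α) (coeff y α)) (sym (coeff-++ y x α)))) ⟫

++-assoc : ∀ x y z → (x ++ y) ++ z ≋ x ++ (y ++ z)
++-assoc x y z = ≋-reflexive (LP.++-assoc x y z)

++-identityʳ : ∀ x → x ++ [] ≋ x
++-identityʳ x = ≋-reflexive (LP.++-identityʳ x)

++-emptyˡ : ∀ {x y} → x ≋ [] → x ++ y ≋ y
++-emptyˡ {x} {y} p = ⟪ (λ α → trans (coeff-++ x y α)
  (trans (cong (ℚ._+ coeff y α) (coeff-≡ p α)) (ℚP.+-identityˡ _))) ⟫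

++-emptyʳ : ∀ {x y} → y ≋ [] → x ++ y ≋ x
++-emptyʳ {x} {y} p = ≋-trans (++-comm x y) (++-emptyˡ p)

++-interchange : ∀ a b c d → (a ++ b) ++ (c ++ d) ≋ (a ++ c) ++ (b ++ d)
++-interchange a b c d = ⟪ (λ α → begin
  coeff ((a ++ b) ++ (c ++ d)) α
    ≡⟨ trans (coeff-++ (a ++ b) (c ++ d) α) (cong₂ ℚ._+_ (coeff-++ a b α) (coeff-++ c d α)) ⟩
  (coeff a α ℚ.+ coeff b α) ℚ.+ (coeff c α ℚ.+ coeff d α)
    ≡⟨ ℚ+.interchange (coeff a α) (coeff b α) (coeff c α) (coeff d α) ⟩
  (coeff a α ℚ.+ coeff c α) ℚ.+ (coeff b α ℚ.+ coeff d α)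
    ≡⟨ trans (coeff-++ (a ++ c) (b ++ d) α) (cong₂ ℚ._+_ (coeff-++ a c α) (coeff-++ b d α)) ⟨
  coeff ((a ++ c) ++ (b ++ d)) α ∎) ⟫
  where open ≡-Reasoning

++-swap-front : ∀ a b c → a ++ (b ++ c) ≋ b ++ (a ++ c)
++-swap-front a b c = ≋-trans (≋-sym (++-assoc a b c))
  (≋-trans (++-cong (++-comm a b) (≋-refl {c})) (++-assoc b a c))

scale-cong : ∀ c {x y} → x ≋ y → scale c x ≋ scale c y
scale-cong c {x} {y} p = ⟪ (λ α → trans (coeff-scale c x α)
  (trans (cong (c *_) (coeff-≡ p α)) (sym (coeff-scale c y α)))) ⟫

scale-++ : ∀ c x y → scale c (x ++ y) ≋ scale c x ++ scale c y
scale-++ c x y = ≋-reflexive (LP.map-++ _ x y)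

scale-scale : ∀ c d x → scale c (scale d x) ≋ scale (c * d) x
scale-scale c d x = ⟪ (λ α → begin
  coeff (scale c (scale d x)) α   ≡⟨ trans (coeff-scale c (scale d x) α) (cong (c *_) (coeff-scale d x α)) ⟩
  c * (d * coeff x α)             ≡⟨ ℚP.*-assoc c d (coeff x α) ⟨
  c * d * coeff x α               ≡⟨ coeff-scale (c * d) x α ⟨
  coeff (scale (c * d) x) α       ∎) ⟫
  where open ≡-Reasoning

scale-comm : ∀ c d x → scale c (scale d x) ≋ scale d (scale c x)
scale-comm c d x = ≋-trans (scale-scale c d x)
  (≋-trans (≋-reflexive (cong (λ e → scale e x) (ℚP.*-comm c d))) (≋-sym (scale-scale d c x)))

scale-+ : ∀ c d x → scale (c ℚ.+ d) x ≋ scale c x ++ scale d x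
scale-+ c d x = ⟪ (λ α → trans (coeff-scale (c ℚ.+ d) x α) (trans (ℚP.*-distribʳ-+ (coeff x α) c d)
  (sym (trans (coeff-++ (scale c x) (scale d x) α) (cong₂ ℚ._+_ (coeff-scale c x α) (coeff-scale d x α)))))) ⟫

scale-1 : ∀ x → scale 1ℚ x ≋ x
scale-1 x = ⟪ (λ α → trans (coeff-scale 1ℚ x α) (ℚP.*-identityˡ (coeff x α))) ⟫

scale-0 : ∀ x → scale 0ℚ x ≋ []
scale-0 x = ⟪ (λ α → trans (coeff-scale 0ℚ x α) (ℚP.*-zeroˡ (coeff x α))) ⟫

scale-empty : ∀ c {x} → x ≋ [] → scale c x ≋ []
scale-empty c = scale-cong c

single≋scale-basis : ∀ c α → (c , α) ∷ [] ≋ scale c (basis α)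
single≋scale-basis c α = ⟪ (λ γ → sym (trans (coeff-scale c (basis α) γ) (scaled γ))) ⟫
  where
  scaled : ∀ γ → c * coeff (basis α) γ ≡ coeff ((c , α) ∷ []) γ
  scaled γ with α ==ᶜ γ
  ... | true  = trans (cong (c *_) (ℚP.+-identityʳ 1ℚ)) (trans (ℚP.*-identityʳ c) (sym (ℚP.+-identityʳ c)))
  ... | false = ℚP.*-zeroʳ c

neg : Lin → Lin
neg = scale (- 1ℚ)

++-negʳ : ∀ x → x ++ neg x ≋ []
++-negʳ x = ⟪ (λ α → trans (coeff-++ x (neg x) α)
  (trans (cong (coeff x α ℚ.+_) (coeff-scale (- 1ℚ) x α)) (cancel (coeff x α)))) ⟫
  where
  cancel : ∀ a → a ℚ.+ (- 1ℚ) * a ≡ 0ℚ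
  cancel = solve 1 (λ a → a :+ (:- con 1ℚ) :* a := con 0ℚ) refl

scale-neg : ∀ c x → scale (- c) x ≋ neg (scale c x)
scale-neg c x = ⟪ (λ α → trans (coeff-scale (- c) x α) (trans (pull-sign c (coeff x α))
  (sym (trans (coeff-scale (- 1ℚ) (scale c x) α) (cong ((- 1ℚ) *_) (coeff-scale c x α)))))) ⟫
  where
  pull-sign : ∀ c a → (- c) * a ≡ (- 1ℚ) * (c * a)
  pull-sign = solve 2 (λ c a → (:- c) :* a := (:- con 1ℚ) :* (c :* a)) refl

module _ {A : Set} where

  concatMap-cong : ∀ {f g : A → Lin} xs → (∀ u → f u ≋ g u) → concatMap f xs ≋ concatMap g xs
  concatMap-cong []       p = ≋-refl
  concatMap-cong (u ∷ xs) p = ++-cong (p u) (concatMap-cong xs p)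

  concatMap-++ᶠ : ∀ (f g : A → Lin) xs → concatMap (λ u → f u ++ g u) xs ≋ concatMap f xs ++ concatMap g xs
  concatMap-++ᶠ f g []       = ≋-refl
  concatMap-++ᶠ f g (u ∷ xs) =
    ≋-trans (++-congˡ (f u ++ g u) (concatMap-++ᶠ f g xs)) (++-interchange (f u) (g u) _ _)

  concatMap-empty : ∀ {f : A → Lin} xs → (∀ u → f u ≋ []) → concatMap f xs ≋ []
  concatMap-empty []       p = ≋-refl
  concatMap-empty (u ∷ xs) p = ≋-trans (++-emptyˡ (p u)) (concatMap-empty xs p)

  concatMap-++ : ∀ (f : A → Lin) xs ys → concatMap f (xs ++ ys) ≋ concatMap f xs ++ concatMap f ys
  concatMap-++ f xs ys = ≋-reflexive (LP.concatMap-++ f xs ys)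

  scale-concatMap : ∀ c (f : A → Lin) xs → scale c (concatMap f xs) ≋ concatMap (λ u → scale c (f u)) xs
  scale-concatMap c f xs = ≋-reflexive (LP.map-concatMap _ f xs)

module _ {A B : Set} where

  concatMap-comm : ∀ (f : A → B → Lin) xs ys →
    concatMap (λ u → concatMap (f u) ys) xs ≋ concatMap (λ v → concatMap (λ u → f u v) xs) ys
  concatMap-comm f []       ys = ≋-sym (concatMap-empty ys (λ _ → ≋-refl))
  concatMap-comm f (u ∷ xs) ys =
    ≋-trans (++-congˡ (concatMap (f u) ys) (concatMap-comm f xs ys))
            (≋-sym (concatMap-++ᶠ (f u) (λ v → concatMap (λ u → f u v) xs) ys))

  concatMap-concatMap : ∀ (f : B → Lin) (g : A → List B) xs →
    concatMap f (concatMap g xs) ≋ concatMap (λ u → concatMap f (g u)) xs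
  concatMap-concatMap f g []       = ≋-refl
  concatMap-concatMap f g (u ∷ xs) =
    ≋-trans (concatMap-++ f (g u) (concatMap g xs)) (++-congˡ (concatMap f (g u)) (concatMap-concatMap f g xs))

  concatMap-map : ∀ (f : B → Lin) (g : A → B) xs → concatMap f (map g xs) ≋ concatMap (λ u → f (g u)) xs
  concatMap-map f g xs = ≋-reflexive (LP.concatMap-map f g xs)

-- The linear extension of f is invariant under ≋, since its γ-coefficient at x is the pairing of x
-- with the functional α ↦ coeff (f α) γ, and the pairing only depends on the coefficients of x.

pairing : Lin → (Comp → ℚ) → ℚ
pairing []            h = 0ℚ
pairing ((c , α) ∷ x) h = c * h α ℚ.+ pairing x h

coeff-linExt : ∀ f x γ → coeff (linExt f x) γ ≡ pairing x (λ α → coeff (f α) γ)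
coeff-linExt f []            γ = refl
coeff-linExt f ((c , α) ∷ x) γ =
  trans (coeff-++ (scale c (f α)) (linExt f x) γ) (cong₂ ℚ._+_ (coeff-scale c (f α) γ) (coeff-linExt f x γ))

remove : Comp → Lin → Lin
remove α []            = []
remove α ((c , β) ∷ x) = if β ==ᶜ α then remove α x else (c , β) ∷ remove α x

pairing-remove : ∀ x h α → pairing x h ≡ coeff x α * h α ℚ.+ pairing (remove α x) h
pairing-remove [] h α = sym (trans (cong (ℚ._+ 0ℚ) (ℚP.*-zeroˡ (h α))) (ℚP.+-identityʳ 0ℚ))
pairing-remove ((c , β) ∷ x) h α with β ≟ᶜ α
... | yes refl = trans (cong (c * h β ℚ.+_) (pairing-remove x h β)) (collect c (coeff x β) (h β) _)
  where
  collect : ∀ c k e p → c * e ℚ.+ (k * e ℚ.+ p) ≡ (c ℚ.+ k) * e ℚ.+ p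
  collect = solve 4 (λ c k e p → c :* e :+ (k :* e :+ p) := (c :+ k) :* e :+ p) refl
... | no _ = trans (cong (c * h β ℚ.+_) (pairing-remove x h α))
  (ℚ+.x∙yz≈y∙xz (c * h β) (coeff x α * h α) (pairing (remove α x) h))

coeff-remove-self : ∀ x α → coeff (remove α x) α ≡ 0ℚ
coeff-remove-self []            α = refl
coeff-remove-self ((c , β) ∷ x) α with β ≟ᶜ α
... | yes _  = coeff-remove-self x α
... | no β≢α rewrite ==ᶜ-false β≢α = coeff-remove-self x α

coeff-remove-other : ∀ x α γ → γ ≢ α → coeff (remove α x) γ ≡ coeff x γ
coeff-remove-other []            α γ γ≢α = refl
coeff-remove-other ((c , β) ∷ x) α γ γ≢α with β ≟ᶜ α
... | yes refl rewrite ==ᶜ-false (γ≢α ∘ sym) = coeff-remove-other x α γ γ≢α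
... | no _ with β ==ᶜ γ
...   | true  = cong (c ℚ.+_) (coeff-remove-other x α γ γ≢α)
...   | false = coeff-remove-other x α γ γ≢α

remove-cong : ∀ {x y} α → x ≋ y → remove α x ≋ remove α y
remove-cong {x} {y} α p = ⟪ coeffs ⟫
  where
  coeffs : ∀ γ → coeff (remove α x) γ ≡ coeff (remove α y) γ
  coeffs γ with γ ≟ᶜ α
  ... | yes refl = trans (coeff-remove-self x α) (sym (coeff-remove-self y α))
  ... | no γ≢α   = trans (coeff-remove-other x α γ γ≢α)
                     (trans (coeff-≡ p γ) (sym (coeff-remove-other y α γ γ≢α)))

length-remove : ∀ x α → length (remove α x) ℕ.≤ length x
length-remove []            α = z≤n
length-remove ((c , β) ∷ x) α with β ==ᶜ α
... | true  = ℕP.m≤n⇒m≤1+n (length-remove x α)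
... | false = s≤s (length-remove x α)

length-remove-head : ∀ c x α → length (remove α ((c , α) ∷ x)) ℕ.≤ length x
length-remove-head c x α rewrite dec-true (α ≟ᶜ α) refl = length-remove x α

pairing-cong-remove : ∀ {x y} h α → x ≋ y →
  pairing (remove α x) h ≡ pairing (remove α y) h → pairing x h ≡ pairing y h
pairing-cong-remove {x} {y} h α p q = trans (pairing-remove x h α)
  (trans (cong₂ ℚ._+_ (cong (_* h α) (coeff-≡ p α)) q) (sym (pairing-remove y h α)))

-- n bounds the total length; each step removes one basis index from both sides.
pairing-cong : ∀ n x y h → length x ℕ.+ length y ℕ.≤ n → x ≋ y → pairing x h ≡ pairing y h
pairing-cong n [] [] h _ _ = refl
pairing-cong (suc n) ((c , α) ∷ x) y h (s≤s bound) p = pairing-cong-remove h α p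
  (pairing-cong n (remove α ((c , α) ∷ x)) (remove α y) h
    (ℕP.≤-trans (ℕP.+-mono-≤ (length-remove-head c x α) (length-remove y α)) bound) (remove-cong α p))
pairing-cong (suc n) [] ((c , α) ∷ y) h (s≤s bound) p = pairing-cong-remove h α p
  (pairing-cong n [] (remove α ((c , α) ∷ y)) h (ℕP.≤-trans (length-remove-head c y α) bound) (remove-cong α p))

linExt-cong : ∀ f {x y} → x ≋ y → linExt f x ≋ linExt f y
linExt-cong f {x} {y} p = ⟪ (λ γ → trans (coeff-linExt f x γ)
  (trans (pairing-cong _ x y _ ℕP.≤-refl p) (sym (coeff-linExt f y γ)))) ⟫

linExt-cong-fun : ∀ {f g} x → (∀ α → f α ≋ g α) → linExt f x ≋ linExt g x
linExt-cong-fun []            p = ≋-refl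
linExt-cong-fun ((c , β) ∷ x) p = ++-cong (scale-cong c (p β)) (linExt-cong-fun x p)

linExt-++ : ∀ f x y → linExt f (x ++ y) ≋ linExt f x ++ linExt f y
linExt-++ f x y = concatMap-++ _ x y

linExt-scale : ∀ f c x → linExt f (scale c x) ≋ scale c (linExt f x)
linExt-scale f c []            = ≋-refl
linExt-scale f c ((d , β) ∷ x) = ≋-trans (++-cong (≋-sym (scale-scale c d (f β))) (linExt-scale f c x))
  (≋-sym (scale-++ c (scale d (f β)) (linExt f x)))

linExt-basis : ∀ f α → linExt f (basis α) ≋ f α
linExt-basis f α = ≋-trans (++-identityʳ _) (scale-1 (f α))

record IsLinear (T : Op) : Set where
  field
    lin-cong  : ∀ {x y} → x ≋ y → T x ≋ T y
    lin-++    : ∀ x y → T (x ++ y) ≋ T x ++ T y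
    lin-scale : ∀ c x → T (scale c x) ≋ scale c (T x)

  lin-[] : T [] ≋ []
  lin-[] = ≋-trans (lin-scale 0ℚ []) (scale-0 (T []))

  lin-concatMap : ∀ {A : Set} (g : A → Lin) xs → T (concatMap g xs) ≋ concatMap (λ u → T (g u)) xs
  lin-concatMap g []       = lin-[]
  lin-concatMap g (u ∷ xs) = ≋-trans (lin-++ (g u) (concatMap g xs)) (++-congˡ (T (g u)) (lin-concatMap g xs))

  lin-expand : ∀ x → T x ≋ linExt (λ α → T (H α)) x
  lin-expand []            = lin-[]
  lin-expand ((c , α) ∷ x) = ≋-trans (lin-++ ((c , α) ∷ []) x)
    (++-cong (≋-trans (lin-cong (single≋scale-basis c α)) (lin-scale c (H α))) (lin-expand x))
open IsLinear public

linear-ext : ∀ {T S} → IsLinear T → IsLinear S → (∀ α → T (H α) ≋ S (H α)) → ∀ x → T x ≋ S x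
linear-ext T-lin S-lin p x =
  ≋-trans (lin-expand T-lin x) (≋-trans (linExt-cong-fun x p) (≋-sym (lin-expand S-lin x)))

linExt-linear : ∀ f → IsLinear (linExt f)
linExt-linear f = record { lin-cong = linExt-cong f ; lin-++ = linExt-++ f ; lin-scale = linExt-scale f }

∘-linear : ∀ {T S} → IsLinear T → IsLinear S → IsLinear (T ∘ S)
∘-linear {T} {S} T-lin S-lin = record
  { lin-cong  = lin-cong T-lin ∘ lin-cong S-lin
  ; lin-++    = λ x y → ≋-trans (lin-cong T-lin (lin-++ S-lin x y)) (lin-++ T-lin (S x) (S y))
  ; lin-scale = λ c x → ≋-trans (lin-cong T-lin (lin-scale S-lin c x)) (lin-scale T-lin c (S x)) }

scale-linear : ∀ {T} c → IsLinear T → IsLinear (scale c ∘ T)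
scale-linear {T} c T-lin = record
  { lin-cong  = scale-cong c ∘ lin-cong T-lin
  ; lin-++    = λ x y → ≋-trans (scale-cong c (lin-++ T-lin x y)) (scale-++ c (T x) (T y))
  ; lin-scale = λ d x → ≋-trans (scale-cong c (lin-scale T-lin d x)) (scale-comm c d (T x)) }

concatMap-linear : ∀ {A : Set} {T : A → Op} js → (∀ j → IsLinear (T j)) → IsLinear (λ x → concatMap (λ j → T j x) js)
concatMap-linear {T = T} js T-lin = record
  { lin-cong  = λ p → concatMap-cong js (λ j → lin-cong (T-lin j) p)
  ; lin-++    = λ x y → ≋-trans (concatMap-cong js (λ j → lin-++ (T-lin j) x y))
                                 (concatMap-++ᶠ (λ j → T j x) (λ j → T j y) js)
  ; lin-scale = λ c x → ≋-trans (concatMap-cong js (λ j → lin-scale (T-lin j) c x))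
                                 (≋-sym (scale-concatMap c (λ j → T j x) js)) }

≡ᵇ-refl : ∀ k → (k ℕ.≡ᵇ k) ≡ true
≡ᵇ-refl k = dec-true (k ℕ.≟ k) refl

≡ᵇ-false : ∀ {k r} → k ≢ r → (k ℕ.≡ᵇ r) ≡ false
≡ᵇ-false {k} {r} = dec-false (k ℕ.≟ r)

≡ᵇ-true⇒≡ : ∀ {k r} → (k ℕ.≡ᵇ r) ≡ true → k ≡ r
≡ᵇ-true⇒≡ {k} {r} e = ℕP.≡ᵇ⇒≡ k r (subst T (sym e) tt)

≡ᵇ-sym : ∀ k r → (k ℕ.≡ᵇ r) ≡ (r ℕ.≡ᵇ k)
≡ᵇ-sym zero    zero    = refl
≡ᵇ-sym zero    (suc r) = refl
≡ᵇ-sym (suc k) zero    = refl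
≡ᵇ-sym (suc k) (suc r) = ≡ᵇ-sym k r

≤ᵇ-true : ∀ {m n} → m ℕ.≤ n → (m ℕ.≤ᵇ n) ≡ true
≤ᵇ-true {m} {n} = dec-true (m ℕP.≤? n)

≤ᵇ-false : ∀ {m n} → ¬ m ℕ.≤ n → (m ℕ.≤ᵇ n) ≡ false
≤ᵇ-false {m} {n} = dec-false (m ℕP.≤? n)

when : Bool → Lin → Lin
when b x = if b then x else []

when-cong : ∀ b {x y} → x ≋ y → when b x ≋ when b y
when-cong true  p = p
when-cong false p = ≋-refl

when-true : ∀ {b} x → b ≡ true → when b x ≋ x
when-true x refl = ≋-refl

when-false : ∀ {b} x → b ≡ false → when b x ≋ []
when-false x refl = ≋-refl

sumTo-zero : ∀ f → sumTo 0 f ≋ f 0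
sumTo-zero f = ++-identityʳ (f 0)

sumTo-sucˡ : ∀ n f → sumTo (suc n) f ≋ f 0 ++ sumTo n (f ∘ suc)
sumTo-sucˡ n f = ++-congˡ (f 0) (≋-trans
  (≋-reflexive (cong (concatMap f) (sym (LP.map-upTo suc (suc n))))) (concatMap-map f suc (upTo (suc n))))

sumTo-sucʳ : ∀ n f → sumTo (suc n) f ≋ sumTo n f ++ f (suc n)
sumTo-sucʳ n f = ≋-trans (≋-reflexive (cong (concatMap f) (sym (LP.upTo-∷ʳ (suc n)))))
  (≋-trans (concatMap-++ f (upTo (suc n)) (suc n ∷ [])) (++-congˡ (sumTo n f) (++-identityʳ (f (suc n)))))

sumTo-cong≤ : ∀ n {f g} → (∀ i → i ℕ.≤ n → f i ≋ g i) → sumTo n f ≋ sumTo n g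
sumTo-cong≤ zero    {f} {g} p = ≋-trans (sumTo-zero f) (≋-trans (p 0 z≤n) (≋-sym (sumTo-zero g)))
sumTo-cong≤ (suc n) {f} {g} p = ≋-trans (sumTo-sucʳ n f) (≋-trans
  (++-cong (sumTo-cong≤ n (λ i i≤n → p i (ℕP.m≤n⇒m≤1+n i≤n))) (p (suc n) ℕP.≤-refl)) (≋-sym (sumTo-sucʳ n g)))

sumTo-cong : ∀ n {f g} → (∀ i → f i ≋ g i) → sumTo n f ≋ sumTo n g
sumTo-cong n p = sumTo-cong≤ n (λ i _ → p i)

sumTo-vanish : ∀ n {f} → (∀ i → i ℕ.≤ n → f i ≋ []) → sumTo n f ≋ []
sumTo-vanish n p = ≋-trans (sumTo-cong≤ n p) (concatMap-empty (upTo (suc n)) (λ _ → ≋-refl))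

sumTo-truncate : ∀ {m} n {f} → m ℕ.≤ n → (∀ i → m ℕ.< i → f i ≋ []) → sumTo n f ≋ sumTo m f
sumTo-truncate n m≤n p with ℕP.m≤n⇒m<n∨m≡n m≤n
... | inj₂ refl = ≋-refl
sumTo-truncate (suc n) {f} _ p | inj₁ (s≤s m≤n) =
  ≋-trans (sumTo-sucʳ n f) (≋-trans (++-emptyʳ (p (suc n) (s≤s m≤n))) (sumTo-truncate n m≤n p))

sumTo-comm : ∀ n m (f : ℕ → ℕ → Lin) →
  sumTo n (λ i → sumTo m (f i)) ≋ sumTo m (λ j → sumTo n (λ i → f i j))
sumTo-comm n m f = concatMap-comm f (upTo (suc n)) (upTo (suc m))

sumTo-delta : ∀ k N (X : ℕ → Lin) → k ℕ.≤ N → sumTo N (λ r → when (k ℕ.≡ᵇ r) (X r)) ≋ X k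
sumTo-delta k N X k≤N =
  ≋-trans (sumTo-truncate N k≤N (λ i k<i → when-false (X i) (≡ᵇ-false (ℕP.<⇒≢ k<i)))) (last k)
  where
  last : ∀ k → sumTo k (λ r → when (k ℕ.≡ᵇ r) (X r)) ≋ X k
  last zero    = sumTo-zero (λ r → when (0 ℕ.≡ᵇ r) (X r))
  last (suc k) = ≋-trans (sumTo-sucʳ k (λ r → when (suc k ℕ.≡ᵇ r) (X r)))
    (≋-trans (++-emptyˡ (sumTo-vanish k (λ i i≤k → when-false (X i) (≡ᵇ-false (ℕP.>⇒≢ (s≤s i≤k))))))
             (when-true (X (suc k)) (≡ᵇ-refl k)))

sumTo-triangle : ∀ n (h : ℕ → ℕ → Lin) →
  sumTo n (λ s → sumTo (n ∸ s) (h s)) ≋ sumTo n (λ s′ → sumTo (n ∸ s′) (λ s → h s s′))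
sumTo-triangle n h =
  ≋-trans (sumTo-cong≤ n (λ s s≤n → as-square s (h s) s≤n))
  (≋-trans (sumTo-comm n n _)
  (≋-trans (sumTo-cong n (λ s′ → sumTo-cong n (λ s →
             ≋-reflexive (cong (λ b → when b (h s s′)) (cong (ℕ._≤ᵇ n) (ℕP.+-comm s′ s))))))
  (≋-sym (sumTo-cong≤ n (λ s′ s′≤n → as-square s′ (λ s → h s s′) s′≤n)))))
  where
  as-square : ∀ s (g : ℕ → Lin) → s ℕ.≤ n → sumTo (n ∸ s) g ≋ sumTo n (λ s′ → when (s′ ℕ.+ s ℕ.≤ᵇ n) (g s′))
  as-square s g s≤n = ≋-sym (≋-trans
    (sumTo-truncate n (ℕP.m∸n≤m n s)
      (λ i n∸s<i → when-false (g i) (≤ᵇ-false (ℕP.<⇒≱ n∸s<i ∘ ℕP.m+n≤o⇒m≤o∸n i))))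
    (sumTo-cong≤ (n ∸ s) (λ i i≤n∸s → when-true (g i) (≤ᵇ-true (ℕP.m≤o∸n⇒m+n≤o i s≤n i≤n∸s)))))

-- Since parts p are stored as p − 1, this prepends a part of size s, and nothing when s = 0.
consPart : ℕ → Comp → Comp
consPart zero    c = c
consPart (suc k) c = k ∷ c

size-consPart : ∀ s c → size (consPart s c) ≡ s ℕ.+ size c
size-consPart zero    c = refl
size-consPart (suc s) c = refl

-- The terms H_a ⊗ H_b of the coproduct ΔH_α, where ΔH_n = Σ_{s+t=n} H_s ⊗ H_t.
splittings : Comp → List (Comp × Comp)
splittings []      = ([] , []) ∷ []
splittings (p ∷ α) = concatMap (λ (a , b) → map (λ s → (consPart s a , consPart (suc p ∸ s) b)) (upTo (suc (suc p))))
                               (splittings α)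

Σsplit : Comp → (Comp → Comp → Lin) → Lin
Σsplit α f = concatMap (λ (a , b) → f a b) (splittings α)

Σsplit-[] : ∀ f → Σsplit [] f ≋ f [] []
Σsplit-[] f = ++-identityʳ (f [] [])

Σsplit-cong : ∀ α {f g} → (∀ a b → f a b ≋ g a b) → Σsplit α f ≋ Σsplit α g
Σsplit-cong α p = concatMap-cong (splittings α) (λ (a , b) → p a b)

Σsplit-∷ : ∀ p α f → Σsplit (p ∷ α) f ≋
  Σsplit α (λ a b → sumTo (suc p) (λ s → f (consPart s a) (consPart (suc p ∸ s) b)))
Σsplit-∷ p α f = ≋-trans (concatMap-concatMap f′ splitPart (splittings α))
  (concatMap-cong (splittings α) (λ ab → concatMap-map f′ (part ab) (upTo (suc (suc p)))))
  where
  f′ : Comp × Comp → Lin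
  f′ (a , b) = f a b
  part : Comp × Comp → ℕ → Comp × Comp
  part (a , b) s = (consPart s a , consPart (suc p ∸ s) b)
  splitPart : Comp × Comp → List (Comp × Comp)
  splitPart ab = map (part ab) (upTo (suc (suc p)))

Σsplit-consPart : ∀ t b f → Σsplit (consPart t b) f ≋
  Σsplit b (λ a′ b′ → sumTo t (λ s → f (consPart s a′) (consPart (t ∸ s) b′)))
Σsplit-consPart zero    b f = Σsplit-cong b (λ a′ b′ → ≋-sym (sumTo-zero (λ s → f (consPart s a′) (consPart (0 ∸ s) b′))))
Σsplit-consPart (suc p) b f = Σsplit-∷ p b f

Σsplit-cong-size : ∀ α {f g} → (∀ a b → size a ℕ.+ size b ≡ size α → f a b ≋ g a b) → Σsplit α f ≋ Σsplit α g
Σsplit-cong-size []      {f} {g} p = ≋-trans (Σsplit-[] f) (≋-trans (p [] [] refl) (≋-sym (Σsplit-[] g)))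
Σsplit-cong-size (q ∷ α) {f} {g} p = ≋-trans (Σsplit-∷ q α f) (≋-trans
  (Σsplit-cong-size α (λ a b sizes → sumTo-cong≤ (suc q) (λ s s≤ →
    p (consPart s a) (consPart (suc q ∸ s) b) (split-size a b s sizes s≤))))
  (≋-sym (Σsplit-∷ q α g)))
  where
  split-size : ∀ a b s → size a ℕ.+ size b ≡ size α → s ℕ.≤ suc q →
    size (consPart s a) ℕ.+ size (consPart (suc q ∸ s) b) ≡ size (q ∷ α)
  split-size a b s sizes s≤ = begin
    size (consPart s a) ℕ.+ size (consPart (suc q ∸ s) b)
      ≡⟨ cong₂ ℕ._+_ (size-consPart s a) (size-consPart (suc q ∸ s) b) ⟩
    (s ℕ.+ size a) ℕ.+ ((suc q ∸ s) ℕ.+ size b)   ≡⟨ ℕ+.interchange s (size a) (suc q ∸ s) (size b) ⟩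
    (s ℕ.+ (suc q ∸ s)) ℕ.+ (size a ℕ.+ size b)   ≡⟨ cong₂ ℕ._+_ (ℕP.m+[n∸m]≡n s≤) sizes ⟩
    suc q ℕ.+ size α                               ∎
    where open ≡-Reasoning

Σsplit-++ᶠ : ∀ α f g → Σsplit α (λ a b → f a b ++ g a b) ≋ Σsplit α f ++ Σsplit α g
Σsplit-++ᶠ α f g = concatMap-++ᶠ (λ (a , b) → f a b) (λ (a , b) → g a b) (splittings α)

Σsplit-sumTo : ∀ α n (f : ℕ → Comp → Comp → Lin) →
  Σsplit α (λ a b → sumTo n (λ i → f i a b)) ≋ sumTo n (λ i → Σsplit α (f i))
Σsplit-sumTo α n f = concatMap-comm (λ (a , b) i → f i a b) (splittings α) (upTo (suc n))

lin-Σsplit : ∀ {T} → IsLinear T → ∀ α f → T (Σsplit α f) ≋ Σsplit α (λ a b → T (f a b))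
lin-Σsplit T-lin α f = lin-concatMap T-lin (λ (a , b) → f a b) (splittings α)

splitsOf : ℕ → List (ℕ × ℕ)
splitsOf zero    = []
splitsOf (suc p) = (0 , p) ∷ map (λ (k , t) → (suc k , t)) (splitsOf p)

sumTo-splitsOf : ∀ p (G : ℕ → ℕ → Lin) →
  sumTo p (λ k → G k (p ∸ k)) ≋ G p 0 ++ concatMap (λ (k , t) → G k (suc t)) (splitsOf p)
sumTo-splitsOf zero    G = ≋-trans (sumTo-zero (λ k → G k (0 ∸ k))) (≋-sym (++-identityʳ (G 0 0)))
sumTo-splitsOf (suc p) G = ≋-trans (sumTo-sucˡ p (λ k → G k (suc p ∸ k)))
  (≋-trans (++-congˡ (G 0 (suc p)) (sumTo-splitsOf p (G ∘ suc)))
  (≋-trans (++-swap-front (G 0 (suc p)) (G (suc p) 0) _)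
  (++-congˡ (G (suc p) 0) (++-congˡ (G 0 (suc p))
    (≋-sym (concatMap-map (λ (k , t) → G k (suc t)) (λ (k , t) → (suc k , t)) (splitsOf p)))))))

-- A part p of α goes wholly to b, wholly to a, or is split between them.
Σsplit-∷-cases : ∀ p α f → Σsplit (p ∷ α) f ≋
  Σsplit α (λ a b → f a (p ∷ b) ++ (f (p ∷ a) b ++ concatMap (λ (k , t) → f (k ∷ a) (t ∷ b)) (splitsOf p)))
Σsplit-∷-cases p α f = ≋-trans (Σsplit-∷ p α f) (Σsplit-cong α (λ a b →
  ≋-trans (sumTo-sucˡ p (λ s → f (consPart s a) (consPart (suc p ∸ s) b)))
  (++-congˡ (f a (p ∷ b)) (sumTo-splitsOf p (λ k t → f (k ∷ a) (consPart t b))))))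

-- Σ over the terms H_a ⊗ H_a′ ⊗ H_b′ of the iterated coproduct (id ⊗ Δ)ΔH_α.
Σsplit² : Comp → (Comp → Comp → Comp → Lin) → Lin
Σsplit² α f = Σsplit α (λ a b → Σsplit b (f a))

Σsplit²-cong : ∀ α {f g} → (∀ a a′ b′ → f a a′ b′ ≋ g a a′ b′) → Σsplit² α f ≋ Σsplit² α g
Σsplit²-cong α p = Σsplit-cong α (λ a b → Σsplit-cong b (p a))

Σsplit²-∷ : ∀ p α f → Σsplit² (p ∷ α) f ≋ Σsplit² α (λ a a′ b′ →
  sumTo (suc p) (λ s → sumTo (suc p ∸ s) (λ s′ → f (consPart s a) (consPart s′ a′) (consPart (suc p ∸ s ∸ s′) b′))))
Σsplit²-∷ p α f = ≋-trans (Σsplit-∷ p α _) (Σsplit-cong α (λ a b →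
  ≋-trans (sumTo-cong (suc p) (λ s → Σsplit-consPart (suc p ∸ s) b (f (consPart s a))))
  (≋-sym (Σsplit-sumTo b (suc p) _))))

-- Coassociativity and cocommutativity of Δ; this is what makes all the G^⊥ commute.
Σsplit²-swap : ∀ α f → Σsplit² α f ≋ Σsplit² α (λ a a′ b′ → f a′ a b′)
Σsplit²-swap [] f = ≋-trans (Σsplit-[] (λ a b → Σsplit b (f a))) (≋-trans (Σsplit-[] (f []))
  (≋-sym (≋-trans (Σsplit-[] (λ a b → Σsplit b (λ a′ → f a′ a))) (Σsplit-[] (λ a′ → f a′ [])))))
Σsplit²-swap (p ∷ α) f = ≋-trans (Σsplit²-∷ p α f) (≋-trans (Σsplit²-swap α _) (≋-sym (≋-trans (Σsplit²-∷ p α _)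
  (Σsplit²-cong α (λ a a′ b′ →
    ≋-trans (sumTo-triangle (suc p) (λ s s′ → f (consPart s′ a′) (consPart s a) (consPart (suc p ∸ s ∸ s′) b′)))
     (sumTo-cong (suc p) (λ s → sumTo-cong (suc p ∸ s) (λ s′ →
       ≋-reflexive (cong (λ t → f (consPart s a′) (consPart s′ a) (consPart t b′)) (∸-comm (suc p) s′ s))))))))))
  where
  ∸-comm : ∀ n s s′ → n ∸ s ∸ s′ ≡ n ∸ s′ ∸ s
  ∸-comm n s s′ = trans (ℕP.∸-+-assoc n s s′) (trans (cong (n ∸_) (ℕP.+-comm s s′)) (sym (ℕP.∸-+-assoc n s′ s)))

whenℚ : Bool → ℚ → ℚ
whenℚ b c = if b then c else 0ℚ

coeff-when : ∀ b x β → coeff (when b x) β ≡ whenℚ b (coeff x β)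
coeff-when true  x β = refl
coeff-when false x β = refl

when-∧ : ∀ b c x → when (b ∧ c) x ≡ when b (when c x)
when-∧ true  c x = refl
when-∧ false c x = refl

when-scale : ∀ b c x → when b (scale c x) ≡ scale c (when b x)
when-scale true  c x = refl
when-scale false c x = refl

concatMap-when : ∀ {A : Set} b (f : A → Lin) xs → concatMap (λ u → when b (f u)) xs ≋ when b (concatMap f xs)
concatMap-when true  f xs = ≋-refl
concatMap-when false f xs = concatMap-empty xs (λ _ → ≋-refl)

Σsplit-when : ∀ b α f → Σsplit α (λ a b′ → when b (f a b′)) ≋ when b (Σsplit α f)
Σsplit-when b α f = concatMap-when b (λ (a , b′) → f a b′) (splittings α)

-- Left multiplication by H_{p+1}.
prepend : ℕ → Lin → Lin
prepend p = map (λ (c , β) → (c , p ∷ β))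

coeff-prepend-[] : ∀ p x → coeff (prepend p x) [] ≡ 0ℚ
coeff-prepend-[] p []            = refl
coeff-prepend-[] p ((c , β) ∷ x) = coeff-prepend-[] p x

coeff-prepend-∷ : ∀ p x q β → coeff (prepend p x) (q ∷ β) ≡ whenℚ (p ℕ.≡ᵇ q) (coeff x β)
coeff-prepend-∷ p [] q β with p ℕ.≡ᵇ q
... | true  = refl
... | false = refl
coeff-prepend-∷ p ((c , b) ∷ x) q β with p ℕ.≡ᵇ q | coeff-prepend-∷ p x q β
... | true  | ih = cong (λ r → if b ==ᶜ β then c ℚ.+ r else r) ih
... | false | ih = ih

when-prepend : ∀ b p x → when b (prepend p x) ≡ prepend p (when b x)
when-prepend true  p x = refl
when-prepend false p x = refl

Σsplit-prepend : ∀ p α f → Σsplit α (λ a b → prepend p (f a b)) ≋ prepend p (Σsplit α f)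
Σsplit-prepend p α f = ≋-sym (≋-reflexive (LP.map-concatMap _ (λ (a , b) → f a b) (splittings α)))

coeff-concatMap-prepend-[] : ∀ {A : Set} (xs : List A) (h : A → ℕ) (Y : A → Lin) →
  coeff (concatMap (λ u → prepend (h u) (Y u)) xs) [] ≡ 0ℚ
coeff-concatMap-prepend-[] []       h Y = refl
coeff-concatMap-prepend-[] (u ∷ xs) h Y = trans (coeff-++ (prepend (h u) (Y u)) _ [])
  (trans (cong₂ ℚ._+_ (coeff-prepend-[] (h u) (Y u)) (coeff-concatMap-prepend-[] xs h Y)) (ℚP.+-identityˡ 0ℚ))

coeff-splitsOf : ∀ p g X b β →
  coeff (concatMap (λ (k , t) → prepend t (when (g ℕ.≡ᵇ k) X)) (splitsOf p)) (b ∷ β) ≡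
  whenℚ (suc (g ℕ.+ b) ℕ.≡ᵇ p) (coeff X β)
coeff-splitsOf zero    g       X b β = refl
coeff-splitsOf (suc p) zero    X b β = begin
  coeff (prepend p X ++ concatMap Y (map shift (splitsOf p))) (b ∷ β)
    ≡⟨ coeff-++ (prepend p X) _ (b ∷ β) ⟩
  coeff (prepend p X) (b ∷ β) ℚ.+ coeff (concatMap Y (map shift (splitsOf p))) (b ∷ β)
    ≡⟨ cong₂ ℚ._+_ (coeff-prepend-∷ p X b β) (trans (cong (λ z → coeff z (b ∷ β)) (LP.concatMap-map Y shift (splitsOf p)))
                     (coeff-≡ (concatMap-empty (splitsOf p) (λ _ → ≋-refl)) (b ∷ β))) ⟩
  whenℚ (p ℕ.≡ᵇ b) (coeff X β) ℚ.+ 0ℚ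
    ≡⟨ trans (ℚP.+-identityʳ _) (cong (λ z → whenℚ z (coeff X β)) (≡ᵇ-sym p b)) ⟩
  whenℚ (b ℕ.≡ᵇ p) (coeff X β) ∎
  where
  open ≡-Reasoning
  Y : ℕ × ℕ → Lin
  Y (k , t) = prepend t (when (0 ℕ.≡ᵇ k) X)
  shift : ℕ × ℕ → ℕ × ℕ
  shift (k , t) = (suc k , t)
coeff-splitsOf (suc p) (suc g) X b β =
  trans (cong (λ z → coeff z (b ∷ β)) (LP.concatMap-map Y shift (splitsOf p))) (coeff-splitsOf p g X b β)
  where
  Y : ℕ × ℕ → Lin
  Y (k , t) = prepend t (when (suc g ℕ.≡ᵇ k) X)
  shift : ℕ × ℕ → ℕ × ℕ
  shift (k , t) = (suc k , t)

-- The part of ΔH_α with left factor H_γ.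
sliceΔ : Comp → Comp → Lin
sliceΔ α γ = Σsplit α (λ a b → when (γ ==ᶜ a) (H b))

sliceΔ-∷-[] : ∀ p α → sliceΔ (p ∷ α) [] ≋ prepend p (sliceΔ α [])
sliceΔ-∷-[] p α = ≋-trans (Σsplit-∷-cases p α _) (≋-trans (Σsplit-cong α (λ a b →
    ≋-trans (++-emptyʳ (concatMap-empty (splitsOf p) (λ _ → ≋-refl))) (≋-reflexive (when-prepend ([] ==ᶜ a) p (H b)))))
  (Σsplit-prepend p α (λ a b → when ([] ==ᶜ a) (H b))))

sliceΔ-∷-∷ : ∀ p α g γ → sliceΔ (p ∷ α) (g ∷ γ) ≋
  prepend p (sliceΔ α (g ∷ γ)) ++ (when (g ℕ.≡ᵇ p) (sliceΔ α γ) ++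
    concatMap (λ (k , t) → prepend t (when (g ℕ.≡ᵇ k) (sliceΔ α γ))) (splitsOf p))
sliceΔ-∷-∷ p α g γ = ≋-trans (Σsplit-∷-cases p α _) (≋-trans
  (Σsplit-cong α (λ a b → ++-cong (≋-reflexive (when-prepend ((g ∷ γ) ==ᶜ a) p (H b)))
     (++-cong (≋-reflexive (when-∧ (g ℕ.≡ᵇ p) (γ ==ᶜ a) (H b)))
      (concatMap-cong (splitsOf p) (λ (k , t) → ≋-reflexive (trans (when-∧ (g ℕ.≡ᵇ k) (γ ==ᶜ a) (prepend t (H b)))
          (cong (when (g ℕ.≡ᵇ k)) (when-prepend (γ ==ᶜ a) t (H b)))))))))
  (≋-trans (Σsplit-++ᶠ α _ _) (++-cong (Σsplit-prepend p α _) (≋-trans (Σsplit-++ᶠ α _ _)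
    (++-cong (Σsplit-when (g ℕ.≡ᵇ p) α _)
      (≋-trans (concatMap-comm (λ (a , b) (k , t) → when (g ℕ.≡ᵇ k) (prepend t (when (γ ==ᶜ a) (H b))))
                                (splittings α) (splitsOf p))
       (concatMap-cong (splitsOf p) (λ (k , t) → ≋-trans (concatMap-when (g ℕ.≡ᵇ k) _ (splittings α))
         (≋-trans (when-cong (g ℕ.≡ᵇ k) (Σsplit-prepend t α (λ a b → when (γ ==ᶜ a) (H b))))
           (≋-reflexive (when-prepend (g ℕ.≡ᵇ k) t (sliceΔ α γ))))))))))))

coeff-sliceΔ-∷-∷ : ∀ p α g γ b β → coeff (sliceΔ (p ∷ α) (g ∷ γ)) (b ∷ β) ≡
  whenℚ (p ℕ.≡ᵇ b) (coeff (sliceΔ α (g ∷ γ)) β) ℚ.+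
  (whenℚ (g ℕ.≡ᵇ p) (coeff (sliceΔ α γ) (b ∷ β)) ℚ.+ whenℚ (suc (g ℕ.+ b) ℕ.≡ᵇ p) (coeff (sliceΔ α γ) β))
coeff-sliceΔ-∷-∷ p α g γ b β = trans (coeff-≡ (sliceΔ-∷-∷ p α g γ) (b ∷ β))
  (trans (coeff-++ (prepend p (sliceΔ α (g ∷ γ))) _ (b ∷ β))
  (cong₂ ℚ._+_ (coeff-prepend-∷ p (sliceΔ α (g ∷ γ)) b β)
    (trans (coeff-++ (when (g ℕ.≡ᵇ p) (sliceΔ α γ)) _ (b ∷ β))
      (cong₂ ℚ._+_ (coeff-when (g ℕ.≡ᵇ p) (sliceΔ α γ) (b ∷ β)) (coeff-splitsOf p g (sliceΔ α γ) b β)))))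

count : List Comp → Comp → ℚ
count L α = coeff (map (1ℚ ,_) L) α

count-++ : ∀ L L′ α → count (L ++ L′) α ≡ count L α ℚ.+ count L′ α
count-++ L L′ α = trans (cong (λ z → coeff z α) (LP.map-++ (1ℚ ,_) L L′)) (coeff-++ (map (1ℚ ,_) L) (map (1ℚ ,_) L′) α)

map-∷≡prepend : ∀ q L → map (1ℚ ,_) (map (q ∷_) L) ≡ prepend q (map (1ℚ ,_) L)
map-∷≡prepend q []      = refl
map-∷≡prepend q (δ ∷ L) = cong ((1ℚ , q ∷ δ) ∷_) (map-∷≡prepend q L)

count-map-∷-[] : ∀ q L → count (map (q ∷_) L) [] ≡ 0ℚ
count-map-∷-[] q L = trans (cong (λ z → coeff z []) (map-∷≡prepend q L)) (coeff-prepend-[] q (map (1ℚ ,_) L))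

count-map-∷ : ∀ q L p α → count (map (q ∷_) L) (p ∷ α) ≡ whenℚ (q ℕ.≡ᵇ p) (count L α)
count-map-∷ q L p α = trans (cong (λ z → coeff z (p ∷ α)) (map-∷≡prepend q L)) (coeff-prepend-∷ q (map (1ℚ ,_) L) p α)

count-qsh-∷-∷-[] : ∀ g γ b β → count (qsh (g ∷ γ) (b ∷ β)) [] ≡ 0ℚ
count-qsh-∷-∷-[] g γ b β = begin
  count (qsh (g ∷ γ) (b ∷ β)) []
    ≡⟨ trans (count-++ (map (g ∷_) (qsh γ (b ∷ β))) _ []) (cong (count (map (g ∷_) (qsh γ (b ∷ β))) [] ℚ.+_)
              (count-++ (map (b ∷_) (qsh (g ∷ γ) β)) _ [])) ⟩
  count (map (g ∷_) (qsh γ (b ∷ β))) [] ℚ.+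
    (count (map (b ∷_) (qsh (g ∷ γ) β)) [] ℚ.+ count (map (suc (g ℕ.+ b) ∷_) (qsh γ β)) [])
    ≡⟨ cong₂ ℚ._+_ (count-map-∷-[] g (qsh γ (b ∷ β)))
         (cong₂ ℚ._+_ (count-map-∷-[] b (qsh (g ∷ γ) β)) (count-map-∷-[] (suc (g ℕ.+ b)) (qsh γ β))) ⟩
  0ℚ ℚ.+ (0ℚ ℚ.+ 0ℚ) ∎
  where open ≡-Reasoning

count-qsh-∷-∷ : ∀ g γ b β p α → count (qsh (g ∷ γ) (b ∷ β)) (p ∷ α) ≡
  whenℚ (g ℕ.≡ᵇ p) (count (qsh γ (b ∷ β)) α) ℚ.+
  (whenℚ (b ℕ.≡ᵇ p) (count (qsh (g ∷ γ) β) α) ℚ.+ whenℚ (suc (g ℕ.+ b) ℕ.≡ᵇ p) (count (qsh γ β) α))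
count-qsh-∷-∷ g γ b β p α = trans (count-++ (map (g ∷_) (qsh γ (b ∷ β))) _ (p ∷ α))
  (cong₂ ℚ._+_ (count-map-∷ g (qsh γ (b ∷ β)) p α)
    (trans (count-++ (map (b ∷_) (qsh (g ∷ γ) β)) _ (p ∷ α))
      (cong₂ ℚ._+_ (count-map-∷ b (qsh (g ∷ γ) β) p α) (count-map-∷ (suc (g ℕ.+ b)) (qsh γ β) p α))))

-- ⟨ΔH_α , M_γ ⊗ M_β⟩ = ⟨H_α , M_γ M_β⟩: the coproduct of NSym is dual to the quasi-shuffle product.
coeff-sliceΔ : ∀ α γ β → coeff (sliceΔ α γ) β ≡ count (qsh γ β) α
coeff-sliceΔ [] γ β = trans (coeff-≡ (Σsplit-[] (λ a b → when (γ ==ᶜ a) (H b))) β) (base γ β)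
  where
  base : ∀ γ β → coeff (when (γ ==ᶜ []) (H [])) β ≡ count (qsh γ β) []
  base []      []      = refl
  base []      (q ∷ β) = refl
  base (g ∷ γ) []      = refl
  base (g ∷ γ) (b ∷ β) = sym (trans (count-qsh-∷-∷-[] g γ b β) (trans (ℚP.+-identityˡ _) (ℚP.+-identityˡ 0ℚ)))
coeff-sliceΔ (p ∷ α) [] [] = trans (coeff-≡ (sliceΔ-∷-[] p α) []) (coeff-prepend-[] p (sliceΔ α []))
coeff-sliceΔ (p ∷ α) [] (q ∷ β) = begin
  coeff (sliceΔ (p ∷ α) []) (q ∷ β)          ≡⟨ coeff-≡ (sliceΔ-∷-[] p α) (q ∷ β) ⟩
  coeff (prepend p (sliceΔ α [])) (q ∷ β)    ≡⟨ coeff-prepend-∷ p (sliceΔ α []) q β ⟩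
  whenℚ (p ℕ.≡ᵇ q) (coeff (sliceΔ α []) β)   ≡⟨ cong₂ whenℚ (≡ᵇ-sym p q) (coeff-sliceΔ α [] β) ⟩
  whenℚ (q ℕ.≡ᵇ p) (count (β ∷ []) α)        ≡⟨ count-map-∷ q (β ∷ []) p α ⟨
  count (qsh [] (q ∷ β)) (p ∷ α)             ∎
  where open ≡-Reasoning
coeff-sliceΔ (p ∷ α) (g ∷ γ) [] = trans (coeff-≡ (sliceΔ-∷-∷ p α g γ) [])
  (trans (coeff-++ (prepend p (sliceΔ α (g ∷ γ))) _ [])
  (trans (cong₂ ℚ._+_ (coeff-prepend-[] p (sliceΔ α (g ∷ γ)))
     (trans (coeff-++ (when (g ℕ.≡ᵇ p) (sliceΔ α γ)) _ [])
       (cong₂ ℚ._+_ (trans (coeff-when (g ℕ.≡ᵇ p) (sliceΔ α γ) [])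
                           (cong (whenℚ (g ℕ.≡ᵇ p)) (trans (coeff-sliceΔ α γ []) (cong (λ z → count z α) (qsh-[]ʳ γ)))))
         (coeff-concatMap-prepend-[] (splitsOf p) proj₂ (λ (k , t) → when (g ℕ.≡ᵇ k) (sliceΔ α γ))))))
  (trans (ℚP.+-identityˡ _) (trans (ℚP.+-identityʳ _) (sym (count-map-∷ g (γ ∷ []) p α))))))
  where
  qsh-[]ʳ : ∀ γ → qsh γ [] ≡ γ ∷ []
  qsh-[]ʳ []      = refl
  qsh-[]ʳ (g ∷ γ) = refl
coeff-sliceΔ (p ∷ α) (g ∷ γ) (b ∷ β) = begin
  coeff (sliceΔ (p ∷ α) (g ∷ γ)) (b ∷ β)
    ≡⟨ coeff-sliceΔ-∷-∷ p α g γ b β ⟩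
  whenℚ (p ℕ.≡ᵇ b) (coeff (sliceΔ α (g ∷ γ)) β) ℚ.+
    (whenℚ (g ℕ.≡ᵇ p) (coeff (sliceΔ α γ) (b ∷ β)) ℚ.+ whenℚ (suc (g ℕ.+ b) ℕ.≡ᵇ p) (coeff (sliceΔ α γ) β))
    ≡⟨ cong₂ ℚ._+_ (cong₂ whenℚ (≡ᵇ-sym p b) (coeff-sliceΔ α (g ∷ γ) β))
                   (cong₂ ℚ._+_ (cong (whenℚ (g ℕ.≡ᵇ p)) (coeff-sliceΔ α γ (b ∷ β)))
                                (cong (whenℚ (suc (g ℕ.+ b) ℕ.≡ᵇ p)) (coeff-sliceΔ α γ β))) ⟩
  whenℚ (b ℕ.≡ᵇ p) (count (qsh (g ∷ γ) β) α) ℚ.+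
    (whenℚ (g ℕ.≡ᵇ p) (count (qsh γ (b ∷ β)) α) ℚ.+ whenℚ (suc (g ℕ.+ b) ℕ.≡ᵇ p) (count (qsh γ β) α))
    ≡⟨ ℚ+.x∙yz≈y∙xz (whenℚ (b ℕ.≡ᵇ p) (count (qsh (g ∷ γ) β) α))
                    (whenℚ (g ℕ.≡ᵇ p) (count (qsh γ (b ∷ β)) α)) _ ⟩
  whenℚ (g ℕ.≡ᵇ p) (count (qsh γ (b ∷ β)) α) ℚ.+
    (whenℚ (b ℕ.≡ᵇ p) (count (qsh (g ∷ γ) β) α) ℚ.+ whenℚ (suc (g ℕ.+ b) ℕ.≡ᵇ p) (count (qsh γ β) α))
    ≡⟨ count-qsh-∷-∷ g γ b β p α ⟨
  count (qsh (g ∷ γ) (b ∷ β)) (p ∷ α) ∎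
  where open ≡-Reasoning

compsOf-unfold : ∀ n → Σ (Comp → List Comp) (λ step → compsOf (suc n) ≡ concatMap step (compsOf n))
compsOf-unfold n = _ , refl

-- Names, by unification, the step function local to the definition of compsOf.
compsOf-step : ℕ → Comp → List Comp
compsOf-step n = proj₁ (compsOf-unfold n)

coeff-concatMap-cong : ∀ {A : Set} (f g : A → Lin) xs β β′ → (∀ u → coeff (f u) β ≡ coeff (g u) β′) →
  coeff (concatMap f xs) β ≡ coeff (concatMap g xs) β′
coeff-concatMap-cong f g []       β β′ p = refl
coeff-concatMap-cong f g (u ∷ xs) β β′ p = trans (coeff-++ (f u) _ β)
  (trans (cong₂ ℚ._+_ (p u) (coeff-concatMap-cong f g xs β β′ p)) (sym (coeff-++ (g u) _ β′)))

coeff-compsOf : ∀ (w : Comp → ℚ) k β → coeff (map (λ β′ → (w β′ , β′)) (compsOf k)) β ≡ whenℚ (size β ℕ.≡ᵇ k) (w β)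
coeff-compsOf w zero    []      = ℚP.+-identityʳ (w [])
coeff-compsOf w zero    (p ∷ β) = refl
coeff-compsOf w (suc k) β = trans (cong (λ z → coeff z β) (LP.map-concatMap _ (compsOf-step k) (compsOf k))) (by-shape β)
  where
  W : Comp → Lin
  W c = map (λ β′ → (w β′ , β′)) (compsOf-step k c)
  constant-weight : ∀ e β → coeff (concatMap (λ c → (e , c) ∷ []) (compsOf k)) β ≡ whenℚ (size β ℕ.≡ᵇ k) e
  constant-weight e β = trans (cong (λ z → coeff z β)
    (trans (sym (LP.concatMap-map [_] (e ,_) (compsOf k))) (LP.concatMap-pure (map (e ,_) (compsOf k)))))
    (coeff-compsOf (λ _ → e) k β)
  by-shape : ∀ β → coeff (concatMap W (compsOf k)) β ≡ whenℚ (size β ℕ.≡ᵇ suc k) (w β)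
  by-shape [] = trans (coeff-concatMap-cong W (λ _ → []) (compsOf k) [] [] no-[])
    (coeff-≡ (concatMap-empty (compsOf k) (λ _ → ≋-refl)) [])
    where
    no-[] : ∀ c → coeff (W c) [] ≡ 0ℚ
    no-[] []      = refl
    no-[] (p ∷ c) = refl
  by-shape (zero ∷ β) = trans (coeff-concatMap-cong W (λ c → (w (0 ∷ β) , c) ∷ []) (compsOf k) (0 ∷ β) β new-part)
    (constant-weight (w (0 ∷ β)) β)
    where
    new-part : ∀ c → coeff (W c) (0 ∷ β) ≡ coeff ((w (0 ∷ β) , c) ∷ []) β
    new-part [] with [] ≟ᶜ β
    ... | yes refl = refl
    ... | no _     = refl
    new-part (p ∷ c) with (p ∷ c) ≟ᶜ β
    ... | yes refl = refl
    ... | no _     = refl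
  by-shape (suc q ∷ β) = trans (coeff-concatMap-cong W (λ c → (w (suc q ∷ β) , c) ∷ []) (compsOf k) (suc q ∷ β) (q ∷ β) grown-part)
    (constant-weight (w (suc q ∷ β)) (q ∷ β))
    where
    grown-part : ∀ c → coeff (W c) (suc q ∷ β) ≡ coeff ((w (suc q ∷ β) , c) ∷ []) (q ∷ β)
    grown-part [] = refl
    grown-part (p ∷ c) with p ℕ.≡ᵇ q in p≡q
    ... | false = refl
    ... | true with c ≟ᶜ β
    ...   | yes refl = cong (λ t → w (suc t ∷ c) ℚ.+ 0ℚ) (≡ᵇ-true⇒≡ p≡q)
    ...   | no _     = refl

coeff-map-weight : ∀ e L α → coeff (map (e ,_) L) α ≡ e * count L α
coeff-map-weight e []      α = sym (ℚP.*-zeroʳ e)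
coeff-map-weight e (δ ∷ L) α with δ ==ᶜ α
... | true  = trans (cong (e ℚ.+_) (coeff-map-weight e L α)) (distrib e (count L α))
  where
  distrib : ∀ e c → e ℚ.+ e * c ≡ e * (1ℚ ℚ.+ c)
  distrib = solve 2 (λ e c → e :+ e :* c := e :* (con 1ℚ :+ c)) refl
... | false = coeff-map-weight e L α

coeff-*Q-M : ∀ G β α → coeff (G *Q M β) α ≡ pairing G (λ γ → count (qsh γ β) α)
coeff-*Q-M []            β α = refl
coeff-*Q-M ((c , γ) ∷ G) β α =
  trans (coeff-++ (map (c * 1ℚ ,_) (qsh γ β) ++ []) (G *Q M β) α)
  (cong₂ ℚ._+_ (trans (cong (λ z → coeff z α) (LP.++-identityʳ (map (c * 1ℚ ,_) (qsh γ β))))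
                 (trans (coeff-map-weight (c * 1ℚ) (qsh γ β) α) (cong (_* count (qsh γ β) α) (ℚP.*-identityʳ c))))
               (coeff-*Q-M G β α))

pairing-congʳ : ∀ G {h h′ : Comp → ℚ} → (∀ γ → h γ ≡ h′ γ) → pairing G h ≡ pairing G h′
pairing-congʳ []            e = refl
pairing-congʳ ((c , γ) ∷ G) e = cong₂ ℚ._+_ (cong (c *_) (e γ)) (pairing-congʳ G e)

pairing-zeroʳ : ∀ G → pairing G (λ _ → 0ℚ) ≡ 0ℚ
pairing-zeroʳ []            = refl
pairing-zeroʳ ((c , γ) ∷ G) = trans (cong₂ ℚ._+_ (ℚP.*-zeroʳ c) (pairing-zeroʳ G)) (ℚP.+-identityˡ 0ℚ)

Σsplit-scale≋linExt-sliceΔ : ∀ α G → Σsplit α (λ a b → scale (coeff G a) (H b)) ≋ linExt (sliceΔ α) G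
Σsplit-scale≋linExt-sliceΔ α [] = concatMap-empty (splittings α) (λ (a , b) → scale-0 (H b))
Σsplit-scale≋linExt-sliceΔ α ((c , γ) ∷ G) = ≋-trans (Σsplit-cong α split-coeff) (≋-trans (Σsplit-++ᶠ α _ _)
  (++-cong (≋-trans (Σsplit-cong α (λ a b → ≋-reflexive (when-scale (γ ==ᶜ a) c (H b))))
             (≋-sym (scale-concatMap c (λ (a , b) → when (γ ==ᶜ a) (H b)) (splittings α))))
           (Σsplit-scale≋linExt-sliceΔ α G)))
  where
  split-coeff : ∀ a b → scale (coeff ((c , γ) ∷ G) a) (H b) ≋ when (γ ==ᶜ a) (scale c (H b)) ++ scale (coeff G a) (H b)
  split-coeff a b with γ ==ᶜ a
  ... | true  = scale-+ c (coeff G a) (H b)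
  ... | false = ≋-refl

coeff-sliceΔ-large : ∀ α γ β → size α ℕ.< size β → coeff (sliceΔ α γ) β ≡ 0ℚ
coeff-sliceΔ-large α γ β |α|<|β| =
  trans (coeff-≡ (Σsplit-cong-size α {g = λ a b → when (γ ==ᶜ a) (when (not (b ==ᶜ β)) (H b))} exclude-β) β)
  (trans (coeff-concatMap-cong _ (λ _ → []) (splittings α) β β (λ (a , b) → excluded a b))
    (coeff-≡ (concatMap-empty (splittings α) (λ _ → ≋-refl)) β))
  where
  exclude-β : ∀ a b → size a ℕ.+ size b ≡ size α → when (γ ==ᶜ a) (H b) ≋ when (γ ==ᶜ a) (when (not (b ==ᶜ β)) (H b))
  exclude-β a b sizes rewrite ==ᶜ-false {b} {β} (λ b≡β → ℕP.<⇒≱ |α|<|β|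
    (subst (λ c → size c ℕ.≤ size α) b≡β (subst (size b ℕ.≤_) sizes (ℕP.m≤n+m (size b) (size a))))) = ≋-refl
  excluded : ∀ a b → coeff (when (γ ==ᶜ a) (when (not (b ==ᶜ β)) (H b))) β ≡ 0ℚ
  excluded a b with γ ==ᶜ a
  ... | false = refl
  ... | true with b ≟ᶜ β
  ...   | yes _   = refl
  ...   | no b≢β rewrite ==ᶜ-false b≢β = refl

perp-basis : QSym → Comp → NSym
perp-basis G α = concatMap (λ k → map (λ β → (coeff (G *Q M β) α , β)) (compsOf k)) (upTo (suc (size α)))

coeff-perp-H : ∀ G α β → coeff (perp G (H α)) β ≡ whenℚ (size β ℕ.≤ᵇ size α) (coeff (G *Q M β) α)
coeff-perp-H G α β = begin
  coeff (perp G (H α)) β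
    ≡⟨ coeff-≡ (linExt-basis (perp-basis G) α) β ⟩
  coeff (concatMap (λ k → map (λ β′ → (w β′ , β′)) (compsOf k)) (upTo (suc (size α)))) β
    ≡⟨ coeff-concatMap-cong (λ k → map (λ β′ → (w β′ , β′)) (compsOf k))
                            (λ k → when (size β ℕ.≡ᵇ k) ((w β , β) ∷ []))
         (upTo (suc (size α))) β β (λ k →
         trans (coeff-compsOf w k β) (sym (coeff-when-single (size β ℕ.≡ᵇ k)))) ⟩
  coeff (sumTo (size α) (λ k → when (size β ℕ.≡ᵇ k) ((w β , β) ∷ []))) β
    ≡⟨ pick (size β ℕP.≤? size α) ⟩
  whenℚ (size β ℕ.≤ᵇ size α) (w β) ∎
  where
  open ≡-Reasoning
  w : Comp → ℚ
  w β′ = coeff (G *Q M β′) α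
  coeff-when-single : ∀ b → coeff (when b ((w β , β) ∷ [])) β ≡ whenℚ b (w β)
  coeff-when-single true  = coeff-single (w β) β
  coeff-when-single false = refl
  pick : Dec (size β ℕ.≤ size α) →
    coeff (sumTo (size α) (λ k → when (size β ℕ.≡ᵇ k) ((w β , β) ∷ []))) β ≡ whenℚ (size β ℕ.≤ᵇ size α) (w β)
  pick (yes |β|≤|α|) rewrite ≤ᵇ-true |β|≤|α| =
    trans (coeff-≡ (sumTo-delta (size β) (size α) _ |β|≤|α|) β) (coeff-single (w β) β)
  pick (no |β|≰|α|) rewrite ≤ᵇ-false |β|≰|α| = coeff-≡ (sumTo-vanish (size α) (λ k k≤|α| →
    when-false _ (≡ᵇ-false (λ |β|≡k → |β|≰|α| (subst (ℕ._≤ size α) (sym |β|≡k) k≤|α|))))) β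

-- Coefficientwise, ⟨G^⊥ H_α , M_β⟩ = ⟨H_α , G M_β⟩ = Σ ⟨H_a , G⟩ ⟨H_b , M_β⟩ by coeff-sliceΔ.
perp-H : ∀ G α → perp G (H α) ≋ Σsplit α (λ a b → scale (coeff G a) (H b))
perp-H G α = ⟪ (λ β → trans (coeff-perp-H G α β) (sym (trans (coeff-≡ (Σsplit-scale≋linExt-sliceΔ α G) β)
  (trans (coeff-linExt (sliceΔ α) G β) (by-size β (size β ℕP.≤? size α)))))) ⟫
  where
  by-size : ∀ β → Dec (size β ℕ.≤ size α) →
    pairing G (λ γ → coeff (sliceΔ α γ) β) ≡ whenℚ (size β ℕ.≤ᵇ size α) (coeff (G *Q M β) α)
  by-size β (yes |β|≤|α|) rewrite ≤ᵇ-true |β|≤|α| =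
    trans (pairing-congʳ G (λ γ → coeff-sliceΔ α γ β)) (sym (coeff-*Q-M G β α))
  by-size β (no |β|≰|α|) rewrite ≤ᵇ-false |β|≰|α| =
    trans (pairing-congʳ G (λ γ → coeff-sliceΔ-large α γ β (ℕP.≰⇒> |β|≰|α|))) (pairing-zeroʳ G)

coeff-Fr : ∀ r a → coeff (Fr r) a ≡ whenℚ (size a ℕ.≡ᵇ r) 1ℚ
coeff-Fr zero    []      = ℚP.+-identityʳ 1ℚ
coeff-Fr zero    (p ∷ a) = refl
coeff-Fr (suc k) a = begin
  coeff (map (1ℚ ,_) (filterᵇ (_≤ʳ (k ∷ [])) (compsOf (suc k ℕ.+ 0)))) a
    ≡⟨ cong (λ L → coeff (map (1ℚ ,_) L) a) (all-refine-one-part (compsOf (suc k ℕ.+ 0))) ⟩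
  coeff (map (1ℚ ,_) (compsOf (suc k ℕ.+ 0))) a
    ≡⟨ coeff-compsOf (λ _ → 1ℚ) (suc k ℕ.+ 0) a ⟩
  whenℚ (size a ℕ.≡ᵇ suc k ℕ.+ 0) 1ℚ
    ≡⟨ cong (λ n → whenℚ (size a ℕ.≡ᵇ n) 1ℚ) (ℕP.+-identityʳ (suc k)) ⟩
  whenℚ (size a ℕ.≡ᵇ suc k) 1ℚ ∎
  where
  open ≡-Reasoning
  all-refine-one-part : ∀ L → filterᵇ (_≤ʳ (k ∷ [])) L ≡ L
  all-refine-one-part []      = refl
  all-refine-one-part (β ∷ L) = cong (β ∷_) (all-refine-one-part L)

coeff-map-filterᵇ : ∀ (q : Comp → Bool) L a →
  coeff (map (1ℚ ,_) (filterᵇ q L)) a ≡ coeff (map (λ β → (whenℚ (q β) 1ℚ , β)) L) a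
coeff-map-filterᵇ q []      a = refl
coeff-map-filterᵇ q (β ∷ L) a with q β
... | true  = cong (λ r → if β ==ᶜ a then 1ℚ ℚ.+ r else r) (coeff-map-filterᵇ q L a)
... | false with β ==ᶜ a
...   | true  = trans (coeff-map-filterᵇ q L a) (sym (ℚP.+-identityˡ _))
...   | false = coeff-map-filterᵇ q L a

ones : ℕ → Comp
ones i = replicate i 0

size-ones : ∀ i → size (ones i) ≡ i
size-ones zero    = refl
size-ones (suc i) = cong suc (size-ones i)

∈ᵇ-psumsFrom-below : ∀ x acc c → x ℕ.≤ acc → (x ∈ᵇ psumsFrom acc c) ≡ false
∈ᵇ-psumsFrom-below x acc []          x≤acc = refl
∈ᵇ-psumsFrom-below x acc (p ∷ [])    x≤acc = refl
∈ᵇ-psumsFrom-below x acc (p ∷ q ∷ c) x≤acc =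
  cong₂ _∨_ (≡ᵇ-false (ℕP.>⇒≢ (ℕP.≤-<-trans x≤acc (ℕP.m<m+n acc (s≤s z≤n)))))
    (∈ᵇ-psumsFrom-below x (acc ℕ.+ suc p) (q ∷ c) (ℕP.≤-trans x≤acc (ℕP.m≤m+n acc (suc p))))

all-∈ᵇ-∷-below : ∀ x ys acc c → x ℕ.≤ acc →
  all (_∈ᵇ (x ∷ ys)) (psumsFrom acc c) ≡ all (_∈ᵇ ys) (psumsFrom acc c)
all-∈ᵇ-∷-below x ys acc []          x≤acc = refl
all-∈ᵇ-∷-below x ys acc (p ∷ [])    x≤acc = refl
all-∈ᵇ-∷-below x ys acc (p ∷ q ∷ c) x≤acc =
  cong₂ _∧_ (cong (_∨ ((acc ℕ.+ suc p) ∈ᵇ ys)) (≡ᵇ-false (ℕP.<⇒≢ (ℕP.≤-<-trans x≤acc (ℕP.m<m+n acc (s≤s z≤n))))))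
    (all-∈ᵇ-∷-below x ys (acc ℕ.+ suc p) (q ∷ c) (ℕP.≤-trans x≤acc (ℕP.m≤m+n acc (suc p))))

-- 1^n is refined only by itself, as its partial sums are all of 1, …, n − 1.
≤ʳ-ones : ∀ acc a → all (_∈ᵇ psumsFrom acc a) (psumsFrom acc (ones (size a))) ≡ (a ==ᶜ ones (size a))
≤ʳ-ones acc []              = refl
≤ʳ-ones acc (zero ∷ [])     = refl
≤ʳ-ones acc (suc p ∷ [])    = refl
≤ʳ-ones acc (zero ∷ q ∷ c)  =
  trans (cong (_∧ all (_∈ᵇ psumsFrom acc (zero ∷ q ∷ c)) (psumsFrom (acc ℕ.+ 1) (0 ∷ ones (q ℕ.+ size c))))
           (cong (_∨ ((acc ℕ.+ 1) ∈ᵇ psumsFrom (acc ℕ.+ 1) (q ∷ c))) (≡ᵇ-refl (acc ℕ.+ 1))))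
  (trans (all-∈ᵇ-∷-below (acc ℕ.+ 1) (psumsFrom (acc ℕ.+ 1) (q ∷ c)) (acc ℕ.+ 1) (0 ∷ ones (q ℕ.+ size c)) ℕP.≤-refl)
         (≤ʳ-ones (acc ℕ.+ 1) (q ∷ c)))
≤ʳ-ones acc (suc p ∷ q ∷ c) =
  cong (_∧ all (_∈ᵇ psumsFrom acc (suc p ∷ q ∷ c)) (psumsFrom (acc ℕ.+ 1) (0 ∷ ones (p ℕ.+ size (q ∷ c)))))
    (cong₂ _∨_ (≡ᵇ-false (ℕP.>⇒≢ (ℕP.+-monoʳ-< acc (s≤s (s≤s z≤n)))))
               (∈ᵇ-psumsFrom-below (acc ℕ.+ 1) (acc ℕ.+ suc (suc p)) (q ∷ c) (ℕP.+-monoʳ-≤ acc (s≤s z≤n))))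

coeff-F1s : ∀ i a → coeff (F1s i) a ≡ whenℚ (a ==ᶜ ones i) 1ℚ
coeff-F1s i a = begin
  coeff (F1s i) a
    ≡⟨ coeff-map-filterᵇ (_≤ʳ ones i) (compsOf (size (ones i))) a ⟩
  coeff (map (λ β → (whenℚ (β ≤ʳ ones i) 1ℚ , β)) (compsOf (size (ones i)))) a
    ≡⟨ coeff-compsOf (λ β → whenℚ (β ≤ʳ ones i) 1ℚ) (size (ones i)) a ⟩
  whenℚ (size a ℕ.≡ᵇ size (ones i)) (whenℚ (a ≤ʳ ones i) 1ℚ)
    ≡⟨ cong (λ n → whenℚ (size a ℕ.≡ᵇ n) (whenℚ (a ≤ʳ ones i) 1ℚ)) (size-ones i) ⟩
  whenℚ (size a ℕ.≡ᵇ i) (whenℚ (a ≤ʳ ones i) 1ℚ)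
    ≡⟨ by-size refl ⟩
  whenℚ (a ==ᶜ ones i) 1ℚ ∎
  where
  open ≡-Reasoning
  false≢true : false ≢ true
  false≢true ()
  by-size : ∀ {b} → (size a ℕ.≡ᵇ i) ≡ b → whenℚ b (whenℚ (a ≤ʳ ones i) 1ℚ) ≡ whenℚ (a ==ᶜ ones i) 1ℚ
  by-size {true}  |a|≡i with ≡ᵇ-true⇒≡ {size a} {i} |a|≡i
  ... | refl = cong (λ b → whenℚ b 1ℚ) (≤ʳ-ones 0 a)
  by-size {false} |a|≢i = cong (λ b → whenℚ b 1ℚ) (sym (==ᶜ-false {a} {ones i} (λ a≡1ⁱ → false≢true
    (trans (sym |a|≢i) (trans (cong (λ c → size c ℕ.≡ᵇ i) a≡1ⁱ) (trans (cong (ℕ._≡ᵇ i) (size-ones i)) (≡ᵇ-refl i)))))))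

Hmul : ℤ → Comp → Lin
Hmul (+ zero)  β = H β
Hmul (+ suc k) β = H (k ∷ β)
Hmul -[1+ _ ]  β = []

-- Names, by unification, the basis map local to the definition of HL.
HL-unfold : ∀ m → Σ (Comp → NSym) (λ f → HL m ≡ linExt f)
HL-unfold m = _ , refl

HL-H : ∀ m β → HL m (H β) ≋ Hmul m β
HL-H (+ zero)  β = linExt-basis (proj₁ (HL-unfold (+ zero))) β
HL-H (+ suc k) β = linExt-basis (proj₁ (HL-unfold (+ suc k))) β
HL-H -[1+ n ]  β = linExt-basis (proj₁ (HL-unfold -[1+ n ])) β

Hmul-+ : ∀ t b → Hmul (+ t) b ≡ H (consPart t b)
Hmul-+ zero    b = refl
Hmul-+ (suc t) b = refl

Hmul-∸ : ∀ n j b → Hmul (+ n - + j) b ≋ when (j ℕ.≤ᵇ n) (H (consPart (n ∸ j) b))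
Hmul-∸ n j b with j ℕP.≤? n
... | yes j≤n rewrite ℤP.m-n≡m⊖n n j | ℤP.⊖-≥ j≤n | ≤ᵇ-true j≤n = ≋-reflexive (Hmul-+ (n ∸ j) b)
... | no j≰n rewrite ℤP.m-n≡m⊖n n j | ℤP.⊖-< (ℕP.≰⇒> j≰n) | ≤ᵇ-false j≰n
  with j ∸ n | ℕP.m>n⇒m∸n≢0 (ℕP.≰⇒> j≰n)
...   | zero  | j∸n≢0 = ⊥-elim (j∸n≢0 refl)
...   | suc _ | _     = ≋-refl

series-basis : (ℕ → Op) → Comp → NSym
series-basis T α = sumTo (size α) (λ i → T i (H α))

𝔹-term : ℤ → ℕ → Op
𝔹-term m i x = scale (sign i) (HL (m + + i) (perp (F1s i) x))

HL-linear : ∀ m → IsLinear (HL m)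
HL-linear m = linExt-linear (proj₁ (HL-unfold m))

perp-linear : ∀ G → IsLinear (perp G)
perp-linear G = linExt-linear (perp-basis G)

𝔹-linear : ∀ m → IsLinear (𝔹 m)
𝔹-linear m = linExt-linear (series-basis (𝔹-term m))

lin-when : ∀ {T} → IsLinear T → ∀ b x → T (when b x) ≋ when b (T x)
lin-when T-lin true  x = ≋-refl
lin-when T-lin false x = lin-[] T-lin

scale-coeff≋when : ∀ G a b β → coeff G a ≡ whenℚ b 1ℚ → scale (coeff G a) (H β) ≋ when b (H β)
scale-coeff≋when G a true  β e rewrite e = scale-1 (H β)
scale-coeff≋when G a false β e rewrite e = scale-0 (H β)

perp-Fr-H : ∀ r α → perp (Fr r) (H α) ≋ Σsplit α (λ a b → when (size a ℕ.≡ᵇ r) (H b))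
perp-Fr-H r α = ≋-trans (perp-H (Fr r) α) (Σsplit-cong α (λ a b → scale-coeff≋when (Fr r) a _ b (coeff-Fr r a)))

perp-F1s-H : ∀ i α → perp (F1s i) (H α) ≋ Σsplit α (λ a b → when (a ==ᶜ ones i) (H b))
perp-F1s-H i α = ≋-trans (perp-H (F1s i) α) (Σsplit-cong α (λ a b → scale-coeff≋when (F1s i) a _ b (coeff-F1s i a)))

perp-F1s-H-large : ∀ i α → size α ℕ.< i → perp (F1s i) (H α) ≋ []
perp-F1s-H-large i α |α|<i = ≋-trans (perp-F1s-H i α)
  (≋-trans (Σsplit-cong-size α {g = λ _ _ → []} too-large) (concatMap-empty (splittings α) (λ _ → ≋-refl)))
  where
  too-large : ∀ a b → size a ℕ.+ size b ≡ size α → when (a ==ᶜ ones i) (H b) ≋ []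
  too-large a b sizes rewrite ==ᶜ-false {a} {ones i} (λ a≡1ⁱ → ℕP.<⇒≱ |α|<i
    (subst (ℕ._≤ size α) (trans (cong size a≡1ⁱ) (size-ones i)) (subst (size a ℕ.≤_) sizes (ℕP.m≤m+n (size a) (size b))))) = ≋-refl

perp-perp-H : ∀ G K α → perp G (perp K (H α)) ≋ Σsplit² α (λ a a′ b′ → scale (coeff K a) (scale (coeff G a′) (H b′)))
perp-perp-H G K α = ≋-trans (lin-cong (perp-linear G) (perp-H K α))
  (≋-trans (lin-Σsplit (perp-linear G) α (λ a b → scale (coeff K a) (H b)))
  (Σsplit-cong α (λ a b → ≋-trans (lin-scale (perp-linear G) (coeff K a) (H b))
     (≋-trans (scale-cong (coeff K a) (perp-H G b))
       (scale-concatMap (coeff K a) (λ (a′ , b′) → scale (coeff G a′) (H b′)) (splittings b))))))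

perp-comm : ∀ G K x → perp G (perp K x) ≋ perp K (perp G x)
perp-comm G K = linear-ext (∘-linear (perp-linear G) (perp-linear K)) (∘-linear (perp-linear K) (perp-linear G)) (λ α →
  ≋-trans (perp-perp-H G K α) (≋-trans (Σsplit²-swap α _)
    (≋-trans (Σsplit²-cong α (λ a a′ b′ → scale-comm (coeff K a′) (coeff G a) (H b′))) (≋-sym (perp-perp-H K G α)))))

𝔹-upTo : ℕ → ℤ → Op
𝔹-upTo N k y = sumTo N (λ i → 𝔹-term k i y)

𝔹-upTo-linear : ∀ N k → IsLinear (𝔹-upTo N k)
𝔹-upTo-linear N k = concatMap-linear (upTo (suc N))
  (λ i → scale-linear (sign i) (∘-linear (HL-linear (k + + i)) (perp-linear (F1s i))))

𝔹-H : ∀ m α N → size α ℕ.≤ N → 𝔹 m (H α) ≋ 𝔹-upTo N m (H α)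
𝔹-H m α N |α|≤N = ≋-trans (linExt-basis (series-basis (𝔹-term m)) α) (≋-sym (sumTo-truncate N |α|≤N (λ i |α|<i →
  scale-empty (sign i) (≋-trans (lin-cong (HL-linear (m + + i)) (perp-F1s-H-large i α |α|<i)) (lin-[] (HL-linear (m + + i)))))))

linExt-vanishing : ∀ f x → (∀ α → f α ≋ []) → linExt f x ≋ []
linExt-vanishing f []            p = ≋-refl
linExt-vanishing f ((c , α) ∷ x) p = ≋-trans (++-emptyˡ (scale-empty c (p α))) (linExt-vanishing f x p)

HL-negative : ∀ n x → HL -[1+ n ] x ≋ []
HL-negative n x = ≋-trans (lin-expand (HL-linear -[1+ n ]) x) (linExt-vanishing _ x (HL-H -[1+ n ]))

HL-negative-∸ : ∀ n j x → HL (-[1+ n ] - + j) x ≋ []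
HL-negative-∸ n zero    x = HL-negative n x
HL-negative-∸ n (suc j) x = HL-negative (suc (n ℕ.+ j)) x

≡ᵇ-cong-⇔ : ∀ x y u v → (x ≡ y → u ≡ v) → (u ≡ v → x ≡ y) → (x ℕ.≡ᵇ y) ≡ (u ℕ.≡ᵇ v)
≡ᵇ-cong-⇔ x y u v to from with x ℕ.≟ y
... | yes x≡y = trans (dec-true (x ℕ.≟ y) x≡y) (sym (dec-true (u ℕ.≟ v) (to x≡y)))
... | no x≢y  = trans (≡ᵇ-false x≢y) (sym (≡ᵇ-false (x≢y ∘ from)))

-- The term H_{n−s} H_b of F_r^⊥ (H_n H_β) in which s = r − A is taken from H_n and A = |a| from H_β.
commTerm : ℕ → ℕ → ℕ → Comp → Lin
commTerm n r A b = when (A ℕ.≤ᵇ r) (when (r ∸ A ℕ.≤ᵇ n) (H (consPart (n ∸ (r ∸ A)) b)))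

commTerm-via-ΔHₙ : ∀ n r A b → sumTo n (λ s → when (s ℕ.+ A ℕ.≡ᵇ r) (H (consPart (n ∸ s) b))) ≋ commTerm n r A b
commTerm-via-ΔHₙ n r A b with A ℕP.≤? r
... | no A≰r rewrite ≤ᵇ-false A≰r = sumTo-vanish n (λ s _ →
  when-false _ (≡ᵇ-false (ℕP.>⇒≢ (ℕP.<-≤-trans (ℕP.≰⇒> A≰r) (ℕP.m≤n+m A s)))))
... | yes A≤r rewrite ≤ᵇ-true A≤r = ≋-trans (sumTo-cong n (λ s →
    ≋-reflexive (cong (λ c → when c (H (consPart (n ∸ s) b))) (≡ᵇ-cong-⇔ (s ℕ.+ A) r (r ∸ A) s
      (λ s+A≡r → trans (cong (_∸ A) (sym s+A≡r)) (ℕP.m+n∸n≡m s A))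
      (λ r∸A≡s → trans (cong (ℕ._+ A) (sym r∸A≡s)) (ℕP.m∸n+n≡m A≤r))))))
  (pick ((r ∸ A) ℕP.≤? n))
  where
  pick : Dec (r ∸ A ℕ.≤ n) →
    sumTo n (λ s → when (r ∸ A ℕ.≡ᵇ s) (H (consPart (n ∸ s) b))) ≋ when (r ∸ A ℕ.≤ᵇ n) (H (consPart (n ∸ (r ∸ A)) b))
  pick (yes r∸A≤n) rewrite ≤ᵇ-true r∸A≤n = sumTo-delta (r ∸ A) n (λ s → H (consPart (n ∸ s) b)) r∸A≤n
  pick (no r∸A≰n) rewrite ≤ᵇ-false r∸A≰n = sumTo-vanish n (λ s s≤n →
    when-false _ (≡ᵇ-false (λ r∸A≡s → r∸A≰n (subst (ℕ._≤ n) (sym r∸A≡s) s≤n))))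

commTerm-via-shifts : ∀ n r A b → sumTo r (λ j → when (A ℕ.≡ᵇ r ∸ j) (Hmul (+ n - + j) b)) ≋ commTerm n r A b
commTerm-via-shifts n r A b with A ℕP.≤? r
... | no A≰r rewrite ≤ᵇ-false A≰r = sumTo-vanish r (λ j _ →
  when-false _ (≡ᵇ-false (ℕP.>⇒≢ (ℕP.≤-<-trans (ℕP.m∸n≤m r j) (ℕP.≰⇒> A≰r)))))
... | yes A≤r rewrite ≤ᵇ-true A≤r =
  ≋-trans (sumTo-cong≤ r (λ j j≤r → ≋-reflexive (cong (λ c → when c (Hmul (+ n - + j) b))
    (≡ᵇ-cong-⇔ A (r ∸ j) (r ∸ A) j
      (λ A≡r∸j → trans (cong (r ∸_) A≡r∸j) (ℕP.m∸[m∸n]≡n j≤r))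
      (λ r∸A≡j → trans (sym (ℕP.m∸[m∸n]≡n A≤r)) (cong (r ∸_) r∸A≡j))))))
  (≋-trans (sumTo-delta (r ∸ A) r (λ j → Hmul (+ n - + j) b) (ℕP.m∸n≤m r A)) (Hmul-∸ n (r ∸ A) b))

HL-perp-Fr-H : ∀ m t β → HL m (perp (Fr t) (H β)) ≋ Σsplit β (λ a b → when (size a ℕ.≡ᵇ t) (Hmul m b))
HL-perp-Fr-H m t β = ≋-trans (lin-cong (HL-linear m) (perp-Fr-H t β))
  (≋-trans (lin-Σsplit (HL-linear m) β (λ a b → when (size a ℕ.≡ᵇ t) (H b)))
  (Σsplit-cong β (λ a b → ≋-trans (lin-when (HL-linear m) (size a ℕ.≡ᵇ t) (H b)) (when-cong _ (HL-H m b)))))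

-- ΔF_r = Σ_{j+k=r} F_j ⊗ F_k and F_j^⊥ H_m = H_{m−j}.
perp-Fr-HL-H : ∀ m r β → perp (Fr r) (HL m (H β)) ≋ sumTo r (λ j → HL (m - + j) (perp (Fr (r ∸ j)) (H β)))
perp-Fr-HL-H -[1+ n ] r β = ≋-trans (lin-cong (perp-linear (Fr r)) (HL-H -[1+ n ] β))
  (≋-trans (lin-[] (perp-linear (Fr r))) (≋-sym (sumTo-vanish r (λ j _ → HL-negative-∸ n j (perp (Fr (r ∸ j)) (H β))))))
perp-Fr-HL-H (+ n) r β = begin
  perp (Fr r) (HL (+ n) (H β))
    ≈⟨ lin-cong (perp-linear (Fr r)) (≋-trans (HL-H (+ n) β) (≋-reflexive (Hmul-+ n β))) ⟩
  perp (Fr r) (H (consPart n β))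
    ≈⟨ ≋-trans (perp-Fr-H r (consPart n β)) (Σsplit-consPart n β _) ⟩
  Σsplit β (λ a b → sumTo n (λ s → when (size (consPart s a) ℕ.≡ᵇ r) (H (consPart (n ∸ s) b))))
    ≈⟨ Σsplit-cong β (λ a b → ≋-trans (sumTo-cong n (λ s →
         ≋-reflexive (cong (λ t → when (t ℕ.≡ᵇ r) (H (consPart (n ∸ s) b))) (size-consPart s a))))
         (commTerm-via-ΔHₙ n r (size a) b)) ⟩
  Σsplit β (λ a b → commTerm n r (size a) b)
    ≈⟨ Σsplit-cong β (λ a b → commTerm-via-shifts n r (size a) b) ⟨
  Σsplit β (λ a b → sumTo r (λ j → when (size a ℕ.≡ᵇ r ∸ j) (Hmul (+ n - + j) b)))
    ≈⟨ Σsplit-sumTo β r _ ⟩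
  sumTo r (λ j → Σsplit β (λ a b → when (size a ℕ.≡ᵇ r ∸ j) (Hmul (+ n - + j) b)))
    ≈⟨ sumTo-cong r (λ j → HL-perp-Fr-H (+ n - + j) (r ∸ j) β) ⟨
  sumTo r (λ j → HL (+ n - + j) (perp (Fr (r ∸ j)) (H β))) ∎
  where open ≋-Reasoning

perp-Fr-HL : ∀ m r x → perp (Fr r) (HL m x) ≋ sumTo r (λ j → HL (m - + j) (perp (Fr (r ∸ j)) x))
perp-Fr-HL m r = linear-ext (∘-linear (perp-linear (Fr r)) (HL-linear m))
  (concatMap-linear (upTo (suc r)) (λ j → ∘-linear (HL-linear (m - + j)) (perp-linear (Fr (r ∸ j)))))
  (perp-Fr-HL-H m r)

𝔹-perp-Fr-H : ∀ k t α → 𝔹 k (perp (Fr t) (H α)) ≋ 𝔹-upTo (size α) k (perp (Fr t) (H α))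
𝔹-perp-Fr-H k t α = begin
  𝔹 k (perp (Fr t) (H α))
    ≈⟨ ≋-trans (lin-cong (𝔹-linear k) (perp-Fr-H t α)) (lin-Σsplit (𝔹-linear k) α _) ⟩
  Σsplit α (λ a b → 𝔹 k (when (size a ℕ.≡ᵇ t) (H b)))
    ≈⟨ Σsplit-cong-size α truncate ⟩
  Σsplit α (λ a b → 𝔹-upTo (size α) k (when (size a ℕ.≡ᵇ t) (H b)))
    ≈⟨ ≋-trans (lin-cong (𝔹-upTo-linear (size α) k) (perp-Fr-H t α)) (lin-Σsplit (𝔹-upTo-linear (size α) k) α _) ⟨
  𝔹-upTo (size α) k (perp (Fr t) (H α)) ∎
  where
  open ≋-Reasoning
  truncate : ∀ a b → size a ℕ.+ size b ≡ size α →
    𝔹 k (when (size a ℕ.≡ᵇ t) (H b)) ≋ 𝔹-upTo (size α) k (when (size a ℕ.≡ᵇ t) (H b))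
  truncate a b sizes = ≋-trans (lin-when (𝔹-linear k) (size a ℕ.≡ᵇ t) (H b))
    (≋-trans (when-cong (size a ℕ.≡ᵇ t) (𝔹-H k b (size α) (subst (size b ℕ.≤_) sizes (ℕP.m≤n+m (size b) (size a)))))
     (≋-sym (lin-when (𝔹-upTo-linear (size α) k) (size a ℕ.≡ᵇ t) (H b))))

+-∸-comm-ℤ : ∀ m i j → m + + i - + j ≡ m - + j + + i
+-∸-comm-ℤ m i j = trans (ℤP.+-assoc m (+ i) (ℤ.- + j))
  (trans (cong (λ w → m + w) (ℤP.+-comm (+ i) (ℤ.- + j))) (sym (ℤP.+-assoc m (ℤ.- + j) (+ i))))

perp-Fr-𝔹 : ∀ m r x → perp (Fr r) (𝔹 m x) ≋ sumTo r (λ j → 𝔹 (m - + j) (perp (Fr (r ∸ j)) x))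
perp-Fr-𝔹 m r = linear-ext (∘-linear (perp-linear (Fr r)) (𝔹-linear m))
  (concatMap-linear (upTo (suc r)) (λ j → ∘-linear (𝔹-linear (m - + j)) (perp-linear (Fr (r ∸ j))))) on-basis
  where
  term : ℕ → ℕ → Comp → Lin
  term i j α = scale (sign i) (HL (m - + j + + i) (perp (F1s i) (perp (Fr (r ∸ j)) (H α))))
  on-basis : ∀ α → perp (Fr r) (𝔹 m (H α)) ≋ sumTo r (λ j → 𝔹 (m - + j) (perp (Fr (r ∸ j)) (H α)))
  on-basis α = begin
    perp (Fr r) (𝔹 m (H α))
      ≈⟨ ≋-trans (lin-cong (perp-linear (Fr r)) (𝔹-H m α (size α) ℕP.≤-refl)) (lin-concatMap (perp-linear (Fr r)) (λ i → 𝔹-term m i (H α)) (upTo (suc (size α)))) ⟩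
    sumTo (size α) (λ i → perp (Fr r) (scale (sign i) (HL (m + + i) (perp (F1s i) (H α)))))
      ≈⟨ sumTo-cong (size α) (λ i → ≋-trans (lin-scale (perp-linear (Fr r)) (sign i) (HL (m + + i) (perp (F1s i) (H α))))
           (≋-trans (scale-cong (sign i) (≋-trans (perp-Fr-HL (m + + i) r (perp (F1s i) (H α))) (sumTo-cong r (λ j → commute i j))))
                    (scale-concatMap (sign i) _ (upTo (suc r))))) ⟩
    sumTo (size α) (λ i → sumTo r (λ j → term i j α))
      ≈⟨ sumTo-comm (size α) r (λ i j → term i j α) ⟩
    sumTo r (λ j → 𝔹-upTo (size α) (m - + j) (perp (Fr (r ∸ j)) (H α)))
      ≈⟨ sumTo-cong r (λ j → 𝔹-perp-Fr-H (m - + j) (r ∸ j) α) ⟨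
    sumTo r (λ j → 𝔹 (m - + j) (perp (Fr (r ∸ j)) (H α))) ∎
    where
    open ≋-Reasoning
    commute : ∀ i j → HL (m + + i - + j) (perp (Fr (r ∸ j)) (perp (F1s i) (H α)))
                    ≋ HL (m - + j + + i) (perp (F1s i) (perp (Fr (r ∸ j)) (H α)))
    commute i j rewrite +-∸-comm-ℤ m i j = lin-cong (HL-linear (m - + j + + i)) (perp-comm (Fr (r ∸ j)) (F1s i) (H α))

isOnes : Comp → Bool
isOnes []      = true
isOnes (p ∷ a) = (p ℕ.≡ᵇ 0) ∧ isOnes a

==ᶜ-ones : ∀ a i → (a ==ᶜ ones i) ≡ isOnes a ∧ (size a ℕ.≡ᵇ i)
==ᶜ-ones []          zero    = refl
==ᶜ-ones []          (suc i) = refl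
==ᶜ-ones (p ∷ a)     zero    = sym (∧-zeroʳ (isOnes (p ∷ a)))
==ᶜ-ones (zero ∷ a)  (suc i) = ==ᶜ-ones a i
==ᶜ-ones (suc p ∷ a) (suc i) = refl

isOnes-consPart : ∀ s a → isOnes a ≡ false → isOnes (consPart s a) ≡ false
isOnes-consPart zero          a e = e
isOnes-consPart (suc zero)    a e = e
isOnes-consPart (suc (suc s)) a e = refl

whenPos : ℕ → Lin → Lin
whenPos zero    x = []
whenPos (suc _) x = x

whenPos-cong : ∀ t {x y} → x ≋ y → whenPos t x ≋ whenPos t y
whenPos-cong zero    p = ≋-refl
whenPos-cong (suc t) p = p

sumTo-first-two : ∀ t (Q : ℕ → Lin) → (∀ k → Q (suc (suc k)) ≋ []) → sumTo t Q ≋ Q 0 ++ whenPos t (Q 1)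
sumTo-first-two zero    Q vanish = ≋-trans (sumTo-zero Q) (≋-sym (++-identityʳ (Q 0)))
sumTo-first-two (suc t) Q vanish = ≋-trans (sumTo-sucˡ t Q) (++-congˡ (Q 0) (rest t))
  where
  rest : ∀ t → sumTo t (Q ∘ suc) ≋ Q 1
  rest zero    = sumTo-zero (Q ∘ suc)
  rest (suc t) = ≋-trans (sumTo-sucˡ t (Q ∘ suc)) (++-emptyʳ (sumTo-vanish t (λ k _ → vanish k)))

sumTo-telescope : ∀ n (G : ℕ → Lin) → sumTo n (λ s → G s ++ whenPos (n ∸ s) (neg (G (suc s)))) ≋ G 0
sumTo-telescope zero    G = ≋-trans (sumTo-zero (λ s → G s ++ whenPos (0 ∸ s) (neg (G (suc s))))) (++-identityʳ (G 0))
sumTo-telescope (suc n) G = ≋-trans (sumTo-sucˡ n (λ s → G s ++ whenPos (suc n ∸ s) (neg (G (suc s)))))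
  (≋-trans (++-congˡ (G 0 ++ neg (G 1)) (sumTo-telescope n (G ∘ suc)))
  (≋-trans (++-assoc (G 0) (neg (G 1)) (G 1)) (++-emptyʳ (≋-trans (++-comm (neg (G 1)) (G 1)) (++-negʳ (G 1))))))

-- The term at H_a ⊗ H_a′ ⊗ H_b′ of ΔΔH_α in Σ_i (−1)^i φ_{|a|+i} F_{1^i}^⊥.
alternatingTerm : (ℕ → Comp → Lin) → Comp → Comp → Comp → Lin
alternatingTerm φ a a′ b′ = when (isOnes a′) (scale (sign (size a′)) (φ (size a ℕ.+ size a′) b′))

-- Within one part of α only a′ = 1^k contributes, through pieces of size 0 or 1 of that part, and these telescope.
alternatingTerm-∷ : ∀ p φ a a′ b′ →
  sumTo (suc p) (λ s → sumTo (suc p ∸ s) (λ s′ →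
    alternatingTerm φ (consPart s a) (consPart s′ a′) (consPart (suc p ∸ s ∸ s′) b′)))
  ≋ alternatingTerm (λ t b → φ t (p ∷ b)) a a′ b′
alternatingTerm-∷ p φ a a′ b′ = by-ones (isOnes a′) refl
  where
  term : ℕ → ℕ → Lin
  term s s′ = alternatingTerm φ (consPart s a) (consPart s′ a′) (consPart (suc p ∸ s ∸ s′) b′)
  G : ℕ → Lin
  G s = scale (sign (size a′)) (φ (s ℕ.+ (size a ℕ.+ size a′)) (consPart (suc p ∸ s) b′))
  by-ones : ∀ b → isOnes a′ ≡ b →
    sumTo (suc p) (λ s → sumTo (suc p ∸ s) (term s)) ≋ alternatingTerm (λ t b → φ t (p ∷ b)) a a′ b′
  by-ones false a′-ones = ≋-trans (sumTo-vanish (suc p) (λ s _ → sumTo-vanish (suc p ∸ s) {term s} (λ s′ _ →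
      when-false _ (isOnes-consPart s′ a′ a′-ones))))
    (≋-sym (when-false _ a′-ones))
  by-ones true a′-ones = ≋-trans (sumTo-cong (suc p) (λ s →
      ≋-trans (sumTo-first-two (suc p ∸ s) (term s) (λ k → ≋-refl)) (++-cong (keep s) (whenPos-cong (suc p ∸ s) (add-one s)))))
    (≋-trans (sumTo-telescope (suc p) G) (≋-sym (when-true _ a′-ones)))
    where
    keep : ∀ s → term s 0 ≋ G s
    keep s rewrite a′-ones = ≋-reflexive (cong (λ t → scale (sign (size a′)) (φ t (consPart (suc p ∸ s) b′)))
      (trans (cong (ℕ._+ size a′) (size-consPart s a)) (ℕP.+-assoc s (size a) (size a′))))
    add-one : ∀ s → term s 1 ≋ neg (G (suc s))
    add-one s rewrite a′-ones
      | trans (cong (ℕ._+ suc (size a′)) (size-consPart s a))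
          (trans (ℕP.+-suc (s ℕ.+ size a) (size a′)) (cong suc (ℕP.+-assoc s (size a) (size a′))))
      | trans (ℕP.∸-+-assoc (suc p) s 1) (cong (suc p ∸_) (ℕP.+-comm s 1))
      = scale-neg (sign (size a′)) (φ (suc s ℕ.+ (size a ℕ.+ size a′)) (consPart (suc p ∸ suc s) b′))

-- Σ_{i+j=n} (−1)^i e_i h_j = δ_{n,0}, on the iterated coproduct.
Σsplit²-alternating : ∀ α (φ : ℕ → Comp → Lin) → Σsplit² α (alternatingTerm φ) ≋ φ 0 α
Σsplit²-alternating [] φ = ≋-trans (Σsplit-[] (λ a b → Σsplit b (alternatingTerm φ a)))
  (≋-trans (Σsplit-[] (alternatingTerm φ [])) (scale-1 (φ 0 [])))
Σsplit²-alternating (p ∷ α) φ = ≋-trans (Σsplit²-∷ p α (alternatingTerm φ))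
  (≋-trans (Σsplit²-cong α (alternatingTerm-∷ p φ)) (Σsplit²-alternating α (λ t b → φ t (p ∷ b))))

𝔹-H-alternating : ∀ m a b → 𝔹 (m + + size a) (H b) ≋ Σsplit b (alternatingTerm (λ t → Hmul (m + + t)) a)
𝔹-H-alternating m a b = begin
  𝔹 k (H b)
    ≈⟨ 𝔹-H k b (size b) ℕP.≤-refl ⟩
  sumTo (size b) (λ i → scale (sign i) (HL (k + + i) (perp (F1s i) (H b))))
    ≈⟨ sumTo-cong (size b) (λ i → ≋-trans (scale-cong (sign i) (HL-perp-F1s-H i)) (scale-concatMap (sign i) _ (splittings b))) ⟩
  sumTo (size b) (λ i → Σsplit b (λ a′ b′ → scale (sign i) (when (a′ ==ᶜ ones i) (Hmul (k + + i) b′))))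
    ≈⟨ Σsplit-sumTo b (size b) _ ⟨
  Σsplit b (λ a′ b′ → sumTo (size b) (λ i → scale (sign i) (when (a′ ==ᶜ ones i) (Hmul (k + + i) b′))))
    ≈⟨ Σsplit-cong-size b only-size-a′ ⟩
  Σsplit b (alternatingTerm (λ t → Hmul (m + + t)) a) ∎
  where
  open ≋-Reasoning
  k = m + + size a
  HL-perp-F1s-H : ∀ i → HL (k + + i) (perp (F1s i) (H b)) ≋ Σsplit b (λ a′ b′ → when (a′ ==ᶜ ones i) (Hmul (k + + i) b′))
  HL-perp-F1s-H i = ≋-trans (lin-cong (HL-linear (k + + i)) (perp-F1s-H i b))
    (≋-trans (lin-Σsplit (HL-linear (k + + i)) b _)
    (Σsplit-cong b (λ a′ b′ → ≋-trans (lin-when (HL-linear (k + + i)) (a′ ==ᶜ ones i) (H b′))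
      (when-cong (a′ ==ᶜ ones i) (HL-H (k + + i) b′)))))
  only-size-a′ : ∀ a′ b′ → size a′ ℕ.+ size b′ ≡ size b →
    sumTo (size b) (λ i → scale (sign i) (when (a′ ==ᶜ ones i) (Hmul (k + + i) b′))) ≋ alternatingTerm (λ t → Hmul (m + + t)) a a′ b′
  only-size-a′ a′ b′ sizes =
    ≋-trans (sumTo-cong (size b) (λ i → ≋-reflexive (trans (sym (when-scale (a′ ==ᶜ ones i) (sign i) _))
       (trans (cong (λ c → when c (scale (sign i) (Hmul (k + + i) b′))) (==ᶜ-ones a′ i))
         (when-∧ (isOnes a′) (size a′ ℕ.≡ᵇ i) _)))))
    (≋-trans (concatMap-when (isOnes a′) _ (upTo (suc (size b))))
    (when-cong (isOnes a′) (≋-trans (sumTo-delta (size a′) (size b) (λ i → scale (sign i) (Hmul (k + + i) b′))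
         (subst (size a′ ℕ.≤_) sizes (ℕP.m≤m+n (size a′) (size b′))))
      (≋-reflexive (cong (λ z → scale (sign (size a′)) (Hmul z b′)) (ℤP.+-assoc m (+ size a) (+ size a′)))))))

series-linear : ∀ (T : ℕ → Op) → IsLinear (series T)
series-linear T = linExt-linear (series-basis T)

HL-series : ∀ m x → HL m x ≋ series (λ r y → 𝔹 (m + + r) (perp (Fr r) y)) x
HL-series m = linear-ext (HL-linear m) (series-linear (λ r y → 𝔹 (m + + r) (perp (Fr r) y))) (λ α → ≋-sym (on-basis α))
  where
  on-basis : ∀ α → series (λ r y → 𝔹 (m + + r) (perp (Fr r) y)) (H α) ≋ HL m (H α)
  on-basis α = begin
    series (λ r y → 𝔹 (m + + r) (perp (Fr r) y)) (H α)
      ≈⟨ linExt-basis (series-basis (λ r y → 𝔹 (m + + r) (perp (Fr r) y))) α ⟩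
    sumTo (size α) (λ r → 𝔹 (m + + r) (perp (Fr r) (H α)))
      ≈⟨ sumTo-cong (size α) (λ r → ≋-trans (lin-cong (𝔹-linear (m + + r)) (perp-Fr-H r α))
           (≋-trans (lin-Σsplit (𝔹-linear (m + + r)) α _) (Σsplit-cong α (λ a b → lin-when (𝔹-linear (m + + r)) _ (H b))))) ⟩
    sumTo (size α) (λ r → Σsplit α (λ a b → when (size a ℕ.≡ᵇ r) (𝔹 (m + + r) (H b))))
      ≈⟨ Σsplit-sumTo α (size α) _ ⟨
    Σsplit α (λ a b → sumTo (size α) (λ r → when (size a ℕ.≡ᵇ r) (𝔹 (m + + r) (H b))))
      ≈⟨ Σsplit-cong-size α (λ a b sizes → sumTo-delta (size a) (size α) (λ r → 𝔹 (m + + r) (H b))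
           (subst (size a ℕ.≤_) sizes (ℕP.m≤m+n (size a) (size b)))) ⟩
    Σsplit α (λ a b → 𝔹 (m + + size a) (H b))
      ≈⟨ Σsplit-cong α (𝔹-H-alternating m) ⟩
    Σsplit² α (alternatingTerm (λ t → Hmul (m + + t)))
      ≈⟨ Σsplit²-alternating α (λ t → Hmul (m + + t)) ⟩
    Hmul (m + + 0) α
      ≡⟨ cong (λ z → Hmul z α) (ℤP.+-identityʳ m) ⟩
    Hmul m α
      ≈⟨ HL-H m α ⟨
    HL m (H α) ∎
    where open ≋-Reasoning

proposition2p5 : (m : ℤ) →
    ((r : ℕ) → (x : NSym) →
      perp (Fr r) (𝔹 m x) ≈ sumTo r (λ j → 𝔹 (m - + j) (perp (Fr (r ∸ j)) x)))
    × ((x : NSym) → HL m x ≈ series (λ r y → 𝔹 (m + + r) (perp (Fr r) y)) x)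
proposition2p5 m = (λ r x → coeff-≡ (perp-Fr-𝔹 m r x)) , (λ x → coeff-≡ (HL-series m x))
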